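{- Let $w\in S_n$ and let $(a,b)$ be a lower outside corner of $D(w)$ with ${\tt rk}_w(a,b)\ge 1$, and set $y=z_{a,b}$. Let $v=wt_{a,w^{ -1}(b)}$ and let $\pi$ be the bigrassmannian permutation with ${\tt Ess}(\pi)=\{(a-1,b-1)\}$ and ${\tt rk}_\pi(a-1,b-1)={\tt rk}_w(a,b)-1$. Then ${\tt Perm}(v\vee\pi)=\Phi(w,y)$ and $\deg(v\vee\pi)=\ell(w)$.
   Context: For $w\in S_n$ (one-line notation): $\ell(w)$ is the Coxeter length; $t_{i,j}$ is the transposition of $i,j$ and $wt_{i,j}$ is obtained from $w$ by swapping the entries in positions $i$ and $j$; ${\tt rk}_w(a,b)=\#\{i\le a:w(i)\le b\}$; $D(w)=\{(i,j): w(i)>j,\ w^{ -1}(j)>i\}$; ${\tt Ess}(w)=\{(i,j)\in D(w):(i+1,j),(i,j+1)\notin D(w)\}$. A lower outside corner of $D(w)$ is $(a,b)\in D(w)$ with no other $(c,d)\in D(w)$ satisfying $c\ge a,d\ge b$. Bruhat order: $u\le u'$ iff ${\tt rk}_u\ge{\tt rk}_{u'}$ entrywise. A permutation $\pi$ is bigrassmannian if $\#{\tt Ess}(\pi)=1$; it is determined by its essential cell and the rank there. An alternating sign matrix (ASM) is a square matrix with entries in $\{ -1,0,1\}$ whose rows and columns each sum to 1 and whose nonzero entries alternate in sign along each row and column. Its corner sum function is ${\tt rk}_A(a,b)=\sum_{i\le a,j\le b}A_{i,j}$. ASMs are partially ordered by $A\ge B$ iff ${\tt rk}_A\le{\tt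 rk}_B$ entrywise; this is a lattice extending Bruhat order on permutation matrices, with join $A\vee B$ the ASM whose corner sum function is the entrywise minimum of ${\tt rk}_A$ and ${\tt rk}_B$. ${\tt Perm}(A)$ is the set of Bruhat-minimal elements of $\{u\in S_n: u\ge A\}$, and $\deg(A)=\min\{\ell(u):u\in{\tt Perm}(A)\}$. For a lower outside corner $(a,b)$ of $D(w)$ with $v=wt_{a,w^{ -1}(b)}$: $\phi(w,z_{a,b})=\{i\in[a-1]: vt_{i,a}>v \text{ and } \ell(vt_{i,a})=\ell(v)+1\}$ and $\Phi(w,z_{a,b})=\{vt_{i,a}: i\in\phi(w,z_{a,b})\}$. -}

module Defs where

open import Data.Nat using (ℕ; zero; suc; _+_; _<_; _≤_; _<?_; _⊓_)
open import Data.Fin using (Fin; toℕ; zero; suc)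
open import Data.Fin.Properties using (_≟_)
open import Data.Fin.Permutation using (Permutation′; _⟨$⟩ʳ_; _⟨$⟩ˡ_; transpose; _∘ₚ_)
open import Data.Integer using (ℤ; +_; _-_) renaming (_+_ to _+ℤ_; _≤_ to _≤ℤ_)
open import Data.List using (List; length; filter; allFin; cartesianProduct)
open import Data.Product using (_×_; _,_; proj₁; proj₂; Σ; ∃)
open import Data.Product.Properties using (≡-dec)
open import Relation.Nullary using (¬_; Dec; yes; no)
open import Relation.Nullary.Decidable using (_×-dec_)
open import Relation.Binary.PropositionalEquality using (_≡_)
open import Function.Bundles using (_⇔_)

-- Conventions: a permutation w ∈ S_n is an element of Permutation′ n
-- (bijection Fin n ↔ Fin n), w(i) = w ⟨$⟩ʳ i, w⁻¹(j) = w ⟨$⟩ˡ j.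
-- Positions/values are 0-indexed: the paper's index k ∈ [n] is the
-- element of Fin n with toℕ = k - 1.

Perm : ℕ → Set
Perm n = Permutation′ n

_≐_ : ∀ {n} → Perm n → Perm n → Set
u ≐ u′ = ∀ i → u ⟨$⟩ʳ i ≡ u′ ⟨$⟩ʳ i

-- w t_{i,j}: swap the entries of w in positions i and j
-- ((w t_{i,j})(k) = w(t_{i,j}(k)))
_·t[_,_] : ∀ {n} → Perm n → Fin n → Fin n → Perm n
w ·t[ i , j ] = transpose i j ∘ₚ w

ℓ : ∀ {n} → Perm n → ℕ
ℓ {n} w = length (filter (λ p → (toℕ (proj₁ p) <? toℕ (proj₂ p))
                               ×-dec (toℕ (w ⟨$⟩ʳ proj₂ p) <? toℕ (w ⟨$⟩ʳ proj₁ p)))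
                         (cartesianProduct (allFin n) (allFin n)))

-- rk_w(p,q) = #{i ≤ p : w(i) ≤ q} in the paper's 1-indexed convention,
-- i.e. the number of 0-indexed positions i < p with w(i) < q.
rk : ∀ {n} → Perm n → ℕ → ℕ → ℕ
rk {n} w p q = length (filter (λ i → (toℕ i <? p) ×-dec (toℕ (w ⟨$⟩ʳ i) <? q)) (allFin n))

_≤B_ : ∀ {n} → Perm n → Perm n → Set
u ≤B u′ = ∀ p q → rk u′ p q ≤ rk u p q

_<B_ : ∀ {n} → Perm n → Perm n → Set
u <B u′ = (u ≤B u′) × ¬ (u ≐ u′)

InD : ∀ {n} → Perm n → Fin n → Fin n → Set
InD w i j = (toℕ j < toℕ (w ⟨$⟩ʳ i)) × (toℕ i < toℕ (w ⟨$⟩ˡ j))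

InEss : ∀ {n} → Perm n → Fin n → Fin n → Set
InEss {n} w i j =
  InD w i j
  × (∀ (i′ : Fin n) → toℕ i′ ≡ suc (toℕ i) → ¬ InD w i′ j)
  × (∀ (j′ : Fin n) → toℕ j′ ≡ suc (toℕ j) → ¬ InD w i j′)

LowerOutsideCorner : ∀ {n} → Perm n → Fin n → Fin n → Set
LowerOutsideCorner {n} w a b =
  InD w a b
  × (∀ (c d : Fin n) → InD w c d → toℕ a ≤ toℕ c → toℕ b ≤ toℕ d
       → (c ≡ a × d ≡ b))

Matrix : ℕ → Set
Matrix n = Fin n → Fin n → ℤ

Σℤ : ∀ n → (Fin n → ℤ) → ℤ
Σℤ zero f = + 0
Σℤ (suc n) f = f zero +ℤ Σℤ n (λ i → f (suc i))

[_] : ∀ {p} {P : Set p} → Dec P → ℤ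
[ yes _ ] = + 1
[ no  _ ] = + 0

-- corner sum function rk_A(p,q) = Σ_{i ≤ p, j ≤ q} A_{i,j} (1-indexed p,q;
-- here: 0-indexed i < p, j < q)
rkM : ∀ {n} → Matrix n → ℕ → ℕ → ℤ
rkM {n} A p q = Σℤ n (λ i → Σℤ n (λ j → [ toℕ i <? p ] Data.Integer.* [ toℕ j <? q ] Data.Integer.* A i j))
  where import Data.Integer

permMatrix : ∀ {n} → Perm n → Matrix n
permMatrix w i j = [ w ⟨$⟩ʳ i ≟ j ]

-- join of two matrices in the ASM lattice: the matrix whose corner sum
-- function is the entrywise minimum of rk_A and rk_B (recovered by
-- inclusion–exclusion from that minimum)
_∨_ : ∀ {n} → Matrix n → Matrix n → Matrix n
(A ∨ B) i j = r (suc (toℕ i)) (suc (toℕ j)) - r (toℕ i) (suc (toℕ j))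
              - r (suc (toℕ i)) (toℕ j) +ℤ r (toℕ i) (toℕ j)
  where
  r : ℕ → ℕ → ℤ
  r p q = rkM A p q Data.Integer.⊓ rkM B p q
    where import Data.Integer

_≥M_ : ∀ {n} → Perm n → Matrix n → Set
u ≥M A = ∀ p q → rkM (permMatrix u) p q ≤ℤ rkM A p q

InPermSet : ∀ {n} → Matrix n → Perm n → Set
InPermSet {n} A u = (u ≥M A) × (∀ (u′ : Perm n) → u′ ≥M A → ¬ (u′ <B u))

IsDeg : ∀ {n} → Matrix n → ℕ → Set
IsDeg {n} A d =
  (Σ (Perm n) λ u → InPermSet A u × ℓ u ≡ d)
  × (∀ (u : Perm n) → InPermSet A u → d ≤ ℓ u)

vOf : ∀ {n} → Perm n → Fin n → Fin n → Perm n
vOf w a b = w ·t[ a , w ⟨$⟩ˡ b ]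

-- i ∈ φ(w, z_{a,b})   (i ∈ [a-1] means i < a in 0-indexing)
Inφ : ∀ {n} → Perm n → Fin n → Fin n → Fin n → Set
Inφ w a b i =
  (toℕ i < toℕ a)
  × (vOf w a b <B (vOf w a b ·t[ i , a ]))
  × (ℓ (vOf w a b ·t[ i , a ]) ≡ suc (ℓ (vOf w a b)))

InΦ : ∀ {n} → Perm n → Fin n → Fin n → Perm n → Set
InΦ {n} w a b u = ∃ λ (i : Fin n) → Inφ w a b i × (u ≐ (vOf w a b ·t[ i , a ]))

-- π bigrassmannian with Ess(π) = {(a-1,b-1)} (1-indexed (a,b) is the
-- 0-indexed cell (a,b); (a-1,b-1) is its NW diagonal neighbour) and
-- rk_π(a-1,b-1) = r
IsBigrassAt : ∀ {n} → Perm n → Fin n → Fin n → ℕ → Set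
IsBigrassAt {n} π a b r =
  (∀ (c d : Fin n) → InEss π c d ⇔ (suc (toℕ c) ≡ toℕ a × suc (toℕ d) ≡ toℕ b))
  × (rk π (toℕ a) (toℕ b) ≡ r)

-- Write v = w t_{a,c} with c = w⁻¹(b). As (a, b) is a lower outside corner of D(w), no entry of v lies
-- strictly inside the rectangle spanned by (a, b) and (c, w(a)), so w covers v: ℓ(w) = ℓ(v) + 1, and
-- r := rk_w(a, b) = rk_v(a−1, b−1). The corner sums of v ∨ π are the minimum of those of v and π, and by
-- Fulton's essential set criterion u ≥ π only asks rk_u(a−1, b−1) ≤ r − 1. So u ≥ v ∨ π iff u ≥ v and
-- rk_u(a−1, b−1) < rk_v(a−1, b−1), just north-west of the entry (a, b) of v. For such u the lifting
-- property gives i < a with v t_{i,a} a cover of v below u; this cover is still above v ∨ π, so minimality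
-- forces u = v t_{i,a}. Conversely each such cover is minimal, since the Bruhat interval from v to a cover
-- has only its two endpoints. These covers are Φ(w, y), and all have length ℓ(v) + 1 = ℓ(w).

{-# OPTIONS --safe #-}
module Submission where

open import Defs
open import Data.Nat using (ℕ; zero; suc; _+_; _*_; _∸_; _≤_; _<_; _<?_; _≤?_; z≤n; s≤s; _⊓_)
open import Data.Nat.Properties
open import Data.Nat.Tactic.RingSolver using (solve-∀)
open import Data.Bool using (Bool; true; false; _∧_; not)
open import Data.Fin using (Fin; toℕ; zero; suc; fromℕ<)
open import Data.Fin.Properties using (toℕ-injective; toℕ<n; toℕ-fromℕ<; all?) renaming (_≟_ to _≟F_)
import Data.Fin.Properties as Fin
open import Data.Fin.Permutation using (_⟨$⟩ʳ_; _⟨$⟩ˡ_; transpose; inverseˡ; inverseʳ)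
open import Data.Integer using (ℤ; +≤+)
  renaming (+_ to +ᶻ_; _+_ to _+ᶻ_; _*_ to _*ᶻ_; _-_ to _-ᶻ_; _⊓_ to _⊓ᶻ_; _≤_ to _≤ᶻ_)
import Data.Integer.Properties as ℤ
import Data.Integer.Tactic.RingSolver as ℤ-Solver
open import Data.List using (List; []; _∷_; length; filter; allFin; cartesianProduct; tabulate; map)
open import Data.List.Properties using (length-++; filter-++)
open import Data.Product using (_×_; _,_; proj₁; proj₂; Σ; ∃)
open import Data.Sum using (_⊎_; inj₁; inj₂)
import Data.Sum as ⊎
open import Data.Empty using (⊥; ⊥-elim)
open import Relation.Nullary using (¬_; Dec; yes; no; does)
open import Relation.Nullary.Decidable using (dec-true; dec-false; _×-dec_; ¬?)
open import Level using (0ℓ)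
open import Relation.Unary using (Pred; Decidable)
open import Relation.Binary.PropositionalEquality
  using (_≡_; _≢_; refl; sym; trans; cong; cong₂; subst; subst₂; module ≡-Reasoning)
open import Relation.Binary.Definitions using (tri<; tri≈; tri>)
open import Function.Bundles using (_⇔_; mk⇔; Equivalence)
open import Data.Vec.Functional using (updateAt)
open import Data.Vec.Functional.Properties using (updateAt-updates; updateAt-minimal)
open import Algebra.Properties.CommutativeMonoid.Sum +-0-commutativeMonoid
  using (sum-syntax; sum-cong-≗; sum-replicate-zero; ∑-distrib-+)

-- Indicators and finite sums

χ : Bool → ℕ
χ true = 1
χ false = 0

χ-∧ : ∀ a b → χ (a ∧ b) ≡ χ a * χ b
χ-∧ true b = sym (+-identityʳ (χ b))
χ-∧ false b = refl

χ-not : ∀ b → χ (not b) ≡ 1 ∸ χ b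
χ-not true = refl
χ-not false = refl

𝟙< : ℕ → ℕ → ℕ
𝟙< m n = χ (does (m <? n))

𝟙<-yes : ∀ {m n} → m < n → 𝟙< m n ≡ 1
𝟙<-yes {m} {n} m<n rewrite dec-true (m <? n) m<n = refl

𝟙<-no : ∀ {m n} → ¬ (m < n) → 𝟙< m n ≡ 0
𝟙<-no {m} {n} m≮n rewrite dec-false (m <? n) m≮n = refl

𝟙<-dec : ∀ m n → (m < n × 𝟙< m n ≡ 1) ⊎ (¬ (m < n) × 𝟙< m n ≡ 0)
𝟙<-dec m n with m <? n
... | yes m<n = inj₁ (m<n , 𝟙<-yes m<n)
... | no m≮n = inj₂ (m≮n , 𝟙<-no m≮n)

𝟙<-pos : ∀ {m n} → 0 < 𝟙< m n → m < n
𝟙<-pos {m} {n} pos with 𝟙<-dec m n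
... | inj₁ (m<n , _) = m<n
... | inj₂ (_ , e) = ⊥-elim (<-irrefl (sym e) pos)

𝟙<-irrefl : ∀ m → 𝟙< m m ≡ 0
𝟙<-irrefl m = 𝟙<-no (n≮n m)

𝟙<-suc-self : ∀ m → 𝟙< m (suc m) ≡ 1
𝟙<-suc-self m = 𝟙<-yes (n<1+n m)

𝟙<-suc-≢ : ∀ {m k} → m ≢ k → 𝟙< m (suc k) ≡ 𝟙< m k
𝟙<-suc-≢ {m} {k} m≢k with 𝟙<-dec m (suc k) | 𝟙<-dec m k
... | inj₁ (_ , e) | inj₁ (_ , e′) = trans e (sym e′)
... | inj₂ (_ , e) | inj₂ (_ , e′) = trans e (sym e′)
... | inj₁ (m<1+k , _) | inj₂ (m≮k , _) = ⊥-elim (m≮k (≤∧≢⇒< (≤-pred m<1+k) m≢k))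
... | inj₂ (m≮1+k , _) | inj₁ (m<k , _) = ⊥-elim (m≮1+k (m<n⇒m<1+n m<k))

𝟙<-flip : ∀ {m n} → m ≢ n → 𝟙< n m ≡ χ (not (does (m <? n)))
𝟙<-flip {m} {n} m≢n = trans (flip (𝟙<-dec n m) (𝟙<-dec m n)) (sym (χ-not (does (m <? n))))
  where
  flip : (n < m × 𝟙< n m ≡ 1) ⊎ (¬ (n < m) × 𝟙< n m ≡ 0) → (m < n × 𝟙< m n ≡ 1) ⊎ (¬ (m < n) × 𝟙< m n ≡ 0) →
    𝟙< n m ≡ 1 ∸ 𝟙< m n
  flip (inj₁ (_ , e)) (inj₂ (_ , e′)) rewrite e | e′ = refl
  flip (inj₂ (_ , e)) (inj₁ (_ , e′)) rewrite e | e′ = refl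
  flip (inj₁ (n<m , _)) (inj₁ (m<n , _)) = ⊥-elim (<-asym n<m m<n)
  flip (inj₂ (n≮m , _)) (inj₂ (m≮n , _)) = ⊥-elim (m≢n (≤-antisym (≮⇒≥ n≮m) (≮⇒≥ m≮n)))

does-< : ∀ {m n} → does (m <? n) ≡ true → m < n
does-< {m} {n} e = 𝟙<-pos {m} {n} (subst (λ b → 0 < χ b) (sym e) (s≤s z≤n))

<-does : ∀ {m n} → m < n → does (m <? n) ≡ true
<-does {m} {n} = dec-true (m <? n)

∑-zero : ∀ n {f : Fin n → ℕ} → (∀ i → f i ≡ 0) → ∑[ i < n ] f i ≡ 0
∑-zero n f≡0 = trans (sum-cong-≗ f≡0) (sum-replicate-zero n)

∑-≥ : ∀ n (f : Fin n → ℕ) k → f k ≤ ∑[ i < n ] f i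
∑-≥ (suc n) f zero = m≤m+n _ _
∑-≥ (suc n) f (suc k) = ≤-trans (∑-≥ n (λ i → f (suc i)) k) (m≤n+m _ _)

∑-pos : ∀ n {f : Fin n → ℕ} → 0 < ∑[ i < n ] f i → ∃ λ k → 0 < f k
∑-pos (suc n) {f} pos with f zero in eq
... | suc _ = zero , subst (0 <_) (sym eq) (s≤s z≤n)
... | zero with ∑-pos n {λ i → f (suc i)} pos
... | k , fk>0 = suc k , fk>0

∑-diff : ∀ n {f g : Fin n → ℕ} (k : Fin n) → (∀ i → i ≢ k → f i ≡ g i) →
  ∑[ i < n ] f i + g k ≡ ∑[ i < n ] g i + f k
∑-diff (suc n) {f} {g} zero agree
  rewrite sum-cong-≗ {n} {λ i → f (suc i)} {λ i → g (suc i)} (λ i → agree (suc i) (λ ()))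
  = swap (f zero) (g zero) _
  where
  swap : ∀ a b t → a + t + b ≡ b + t + a
  swap = solve-∀
∑-diff (suc n) {f} {g} (suc k) agree = begin
  f zero + ∑[ i < n ] f (suc i) + g (suc k)   ≡⟨ +-assoc (f zero) _ _ ⟩
  f zero + (∑[ i < n ] f (suc i) + g (suc k)) ≡⟨ cong₂ _+_ (agree zero (λ ())) tail ⟩
  g zero + (∑[ i < n ] g (suc i) + f (suc k)) ≡⟨ +-assoc (g zero) _ _ ⟨
  g zero + ∑[ i < n ] g (suc i) + f (suc k)   ∎
  where
  open ≡-Reasoning
  tail : ∑[ i < n ] f (suc i) + g (suc k) ≡ ∑[ i < n ] g (suc i) + f (suc k)
  tail = ∑-diff n k (λ i i≢k → agree (suc i) (λ e → i≢k (Fin.suc-injective e)))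

∑-diff₂ : ∀ n {f g : Fin n → ℕ} (i j : Fin n) → i ≢ j → (∀ l → l ≢ i → l ≢ j → f l ≡ g l) →
  ∑[ l < n ] f l + g i + g j ≡ ∑[ l < n ] g l + f i + f j
∑-diff₂ n {f} {g} i j i≢j agree = begin
  ∑[ l < n ] f l + g i + g j ≡⟨ cong (λ t → ∑[ l < n ] f l + t + g j) (updateAt-updates i f) ⟨
  ∑[ l < n ] f l + h i + g j ≡⟨ cong (_+ g j) (∑-diff n i (λ l l≢i → sym (updateAt-minimal l i f l≢i))) ⟩
  ∑[ l < n ] h l + f i + g j ≡⟨ swap (∑[ l < n ] h l) (f i) (g j) ⟩
  ∑[ l < n ] h l + g j + f i ≡⟨ cong (_+ f i) (∑-diff n j h≗g) ⟩
  ∑[ l < n ] g l + h j + f i ≡⟨ cong (λ t → ∑[ l < n ] g l + t + f i) (updateAt-minimal j i f (λ e → i≢j (sym e))) ⟩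
  ∑[ l < n ] g l + f j + f i ≡⟨ swap (∑[ l < n ] g l) (f j) (f i) ⟩
  ∑[ l < n ] g l + f i + f j ∎
  where
  open ≡-Reasoning
  h : Fin n → ℕ
  h = updateAt f i (λ _ → g i)
  swap : ∀ a b c → a + b + c ≡ a + c + b
  swap = solve-∀
  h≗g : ∀ l → l ≢ j → h l ≡ g l
  h≗g l l≢j with l ≟F i
  ... | yes refl = updateAt-updates l f
  ... | no l≢i = trans (updateAt-minimal l i f l≢i) (agree l l≢i l≢j)

without : ∀ {n} → Fin n → Fin n → (Fin n → ℕ) → Fin n → ℕ
without i j f l with l ≟F i | l ≟F j
... | yes _ | _ = 0
... | no _ | yes _ = 0
... | no _ | no _ = f l

without-i : ∀ {n} (i j : Fin n) f → without i j f i ≡ 0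
without-i i j f with i ≟F i
... | yes _ = refl
... | no i≢i = ⊥-elim (i≢i refl)

without-j : ∀ {n} (i j : Fin n) f → without i j f j ≡ 0
without-j i j f with j ≟F i | j ≟F j
... | yes _ | _ = refl
... | no _ | yes _ = refl
... | no _ | no j≢j = ⊥-elim (j≢j refl)

without-other : ∀ {n} (i j : Fin n) f l → l ≢ i → l ≢ j → without i j f l ≡ f l
without-other i j f l l≢i l≢j with l ≟F i | l ≟F j
... | yes e | _ = ⊥-elim (l≢i e)
... | no _ | yes e = ⊥-elim (l≢j e)
... | no _ | no _ = refl

without-+ : ∀ {n} (i j : Fin n) f g l → without i j (λ k → f k + g k) l ≡ without i j f l + without i j g l
without-+ i j f g l with l ≟F i | l ≟F j
... | yes _ | _ = refl
... | no _ | yes _ = refl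
... | no _ | no _ = refl

without-pos : ∀ {n} (i j : Fin n) f l → 0 < without i j f l → l ≢ i × l ≢ j × 0 < f l
without-pos i j f l pos with l ≟F i | l ≟F j
without-pos i j f l () | yes _ | _
without-pos i j f l () | no _ | yes _
... | no l≢i | no l≢j = l≢i , l≢j , pos

without-cong : ∀ {n} (i j : Fin n) f g → (∀ l → l ≢ i → l ≢ j → f l ≡ g l) →
  ∀ l → without i j f l ≡ without i j g l
without-cong i j f g agree l with l ≟F i | l ≟F j
... | yes _ | _ = refl
... | no _ | yes _ = refl
... | no l≢i | no l≢j = agree l l≢i l≢j

∑-split₂ : ∀ n (i j : Fin n) → i ≢ j → (f : Fin n → ℕ) →
  ∑[ l < n ] f l ≡ f i + f j + ∑[ l < n ] without i j f l
∑-split₂ n i j i≢j f = begin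
  ∑[ l < n ] f l                             ≡⟨ trans (+-identityʳ _) (+-identityʳ (∑[ l < n ] f l)) ⟨
  ∑[ l < n ] f l + 0 + 0                     ≡⟨ cong₂ (λ s t → ∑[ l < n ] f l + s + t) (without-i i j f) (without-j i j f) ⟨
  ∑[ l < n ] f l + f′ i + f′ j               ≡⟨ ∑-diff₂ n i j i≢j (λ l l≢i l≢j → sym (without-other i j f l l≢i l≢j)) ⟩
  ∑[ l < n ] f′ l + f i + f j                ≡⟨ rotate (∑[ l < n ] f′ l) (f i) (f j) ⟩
  f i + f j + ∑[ l < n ] f′ l                ∎
  where
  open ≡-Reasoning
  f′ = without i j f
  rotate : ∀ a b c → a + b + c ≡ b + c + a
  rotate = solve-∀

∑∑-split₂ : ∀ n (i j : Fin n) → i ≢ j → (F : Fin n → Fin n → ℕ) →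
  ∑[ p < n ] ∑[ q < n ] F p q
    ≡ F i i + F j i + F i j + F j j
      + ∑[ k < n ] without i j (λ k → F k i + F k j + F i k + F j k) k
      + ∑[ p < n ] without i j (λ p → ∑[ q < n ] without i j (F p) q) p
∑∑-split₂ n i j i≢j F =
  trans (sum-cong-≗ (λ p → ∑-split₂ n i j i≢j (F p)))
  (trans (∑-distrib-+ (λ p → F p i + F p j) _)
  (trans (cong (_+ ∑[ p < n ] ∑[ q < n ] without i j (F p) q) (∑-distrib-+ (λ p → F p i) (λ p → F p j)))
  (trans (cong₂ (λ s t → s + t + ∑[ p < n ] ∑[ q < n ] without i j (F p) q)
            (∑-split₂ n i j i≢j (λ p → F p i)) (∑-split₂ n i j i≢j (λ p → F p j)))
  (trans (cong (λ t → (F i i + F j i + C₁) + (F i j + F j j + C₂) + t)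
            (∑-split₂ n i j i≢j (λ p → ∑[ q < n ] without i j (F p) q)))
  (trans (regroup (F i i) (F j i) (F i j) (F j j) C₁ C₂ B₁ B₂ C₃)
  (cong (λ t → F i i + F j i + F i j + F j j + t + C₃) (sym cross)))))))
  where
  C₁ = ∑[ p < n ] without i j (λ p → F p i) p
  C₂ = ∑[ p < n ] without i j (λ p → F p j) p
  B₁ = ∑[ q < n ] without i j (F i) q
  B₂ = ∑[ q < n ] without i j (F j) q
  C₃ = ∑[ p < n ] without i j (λ p → ∑[ q < n ] without i j (F p) q) p
  regroup : ∀ a₁ a₂ a₃ a₄ c₁ c₂ b₁ b₂ c₃ →
    (a₁ + a₂ + c₁) + (a₃ + a₄ + c₂) + (b₁ + b₂ + c₃) ≡ a₁ + a₂ + a₃ + a₄ + (c₁ + c₂ + b₁ + b₂) + c₃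
  regroup = solve-∀
  w : (Fin n → ℕ) → Fin n → ℕ
  w = without i j
  cross : ∑[ k < n ] w (λ k → F k i + F k j + F i k + F j k) k ≡ C₁ + C₂ + B₁ + B₂
  cross = begin
    ∑[ k < n ] w (λ k → F k i + F k j + F i k + F j k) k
      ≡⟨ sum-cong-≗ (λ l → trans (without-+ i j _ _ l)
           (cong₂ _+_ (trans (without-+ i j _ _ l) (cong₂ _+_ (without-+ i j _ _ l) refl)) refl)) ⟩
    ∑[ k < n ] (w (λ k → F k i) k + w (λ k → F k j) k + w (F i) k + w (F j) k)
      ≡⟨ ∑-distrib-+ (λ k → w (λ k → F k i) k + w (λ k → F k j) k + w (F i) k) (w (F j)) ⟩
    ∑[ k < n ] (w (λ k → F k i) k + w (λ k → F k j) k + w (F i) k) + B₂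
      ≡⟨ cong (_+ B₂) (∑-distrib-+ (λ k → w (λ k → F k i) k + w (λ k → F k j) k) (w (F i))) ⟩
    ∑[ k < n ] (w (λ k → F k i) k + w (λ k → F k j) k) + B₁ + B₂
      ≡⟨ cong (λ t → t + B₁ + B₂) (∑-distrib-+ (w (λ k → F k i)) (w (λ k → F k j))) ⟩
    C₁ + C₂ + B₁ + B₂ ∎
    where open ≡-Reasoning

length-filter-tabulate : ∀ {A : Set} n {P : Pred A 0ℓ} (P? : Decidable P) (g : Fin n → A) →
  length (filter P? (tabulate g)) ≡ ∑[ i < n ] χ (does (P? (g i)))
length-filter-tabulate zero P? g = refl
length-filter-tabulate (suc n) P? g with does (P? (g zero))
... | true = cong suc (length-filter-tabulate n P? (λ i → g (suc i)))
... | false = length-filter-tabulate n P? (λ i → g (suc i))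

length-filter-map : ∀ {A B : Set} {P : Pred B 0ℓ} (P? : Decidable P) (h : A → B) (ys : List A) →
  length (filter P? (map h ys)) ≡ length (filter (λ y → P? (h y)) ys)
length-filter-map P? h [] = refl
length-filter-map P? h (y ∷ ys) with does (P? (h y))
... | true = cong suc (length-filter-map P? h ys)
... | false = length-filter-map P? h ys

length-filter-cartesianProduct : ∀ {A B : Set} n {P : Pred (A × B) 0ℓ} (P? : Decidable P)
  (g : Fin n → A) (ys : List B) →
  length (filter P? (cartesianProduct (tabulate g) ys))
    ≡ ∑[ i < n ] length (filter (λ y → P? (g i , y)) ys)
length-filter-cartesianProduct zero P? g ys = refl
length-filter-cartesianProduct (suc n) P? g ys =
  trans (cong length (filter-++ P? (map (g zero ,_) ys) _))
  (trans (length-++ (filter P? (map (g zero ,_) ys)))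
  (cong₂ _+_ (length-filter-map P? (g zero ,_) ys) (length-filter-cartesianProduct n P? (λ i → g (suc i)) ys)))

-- Ranks and inversions of permutations

val : ∀ {n} → Perm n → Fin n → ℕ
val x i = toℕ (x ⟨$⟩ʳ i)

pos : ∀ {n} → Perm n → Fin n → ℕ
pos x j = toℕ (x ⟨$⟩ˡ j)

val-pos : ∀ {n} (x : Perm n) j → val x (x ⟨$⟩ˡ j) ≡ toℕ j
val-pos x j = cong toℕ (inverseʳ x)

⟨$⟩ʳ-injective : ∀ {n} (x : Perm n) {i k} → x ⟨$⟩ʳ i ≡ x ⟨$⟩ʳ k → i ≡ k
⟨$⟩ʳ-injective x {i} {k} e = trans (sym (inverseˡ x)) (trans (cong (x ⟨$⟩ˡ_) e) (inverseˡ x))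

val-injective : ∀ {n} (x : Perm n) {i k} → val x i ≡ val x k → i ≡ k
val-injective x e = ⟨$⟩ʳ-injective x (toℕ-injective e)

transpose-i : ∀ {n} (i j : Fin n) → transpose i j ⟨$⟩ʳ i ≡ j
transpose-i i j rewrite dec-true (i ≟F i) refl = refl

transpose-j : ∀ {n} (i j : Fin n) → transpose i j ⟨$⟩ʳ j ≡ i
transpose-j i j with j ≟F i
... | yes j≡i = j≡i
... | no _ rewrite dec-true (j ≟F j) refl = refl

transpose-other : ∀ {n} (i j k : Fin n) → k ≢ i → k ≢ j → transpose i j ⟨$⟩ʳ k ≡ k
transpose-other i j k k≢i k≢j rewrite dec-false (k ≟F i) k≢i | dec-false (k ≟F j) k≢j = refl

val-transpose-i : ∀ {n} (x : Perm n) i j → val (x ·t[ i , j ]) i ≡ val x j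
val-transpose-i x i j = cong (val x) (transpose-i i j)

val-transpose-j : ∀ {n} (x : Perm n) i j → val (x ·t[ i , j ]) j ≡ val x i
val-transpose-j x i j = cong (val x) (transpose-j i j)

val-transpose-other : ∀ {n} (x : Perm n) i j k → k ≢ i → k ≢ j → val (x ·t[ i , j ]) k ≡ val x k
val-transpose-other x i j k k≢i k≢j = cong (val x) (transpose-other i j k k≢i k≢j)

·t-involutive : ∀ {n} (x : Perm n) i j → x ≐ ((x ·t[ i , j ]) ·t[ i , j ])
·t-involutive x i j k = sym (cong (x ⟨$⟩ʳ_) (tt k (k ≟F i) (k ≟F j)))
  where
  t = transpose i j ⟨$⟩ʳ_
  tt : ∀ k → Dec (k ≡ i) → Dec (k ≡ j) → t (t k) ≡ k
  tt k (yes refl) _ = trans (cong t (transpose-i k j)) (transpose-j k j)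
  tt k (no _) (yes refl) = trans (cong t (transpose-j i k)) (transpose-i i k)
  tt k (no k≢i) (no k≢j) = trans (cong t (transpose-other i j k k≢i k≢j)) (transpose-other i j k k≢i k≢j)

≐-dec : ∀ {n} (x x′ : Perm n) → Dec (x ≐ x′)
≐-dec x x′ = all? (λ i → x ⟨$⟩ʳ i ≟F x′ ⟨$⟩ʳ i)

rank : ∀ {n} → Perm n → ℕ → ℕ → ℕ
rank {n} x p q = ∑[ i < n ] (𝟙< (toℕ i) p * 𝟙< (val x i) q)

rk≡rank : ∀ {n} (x : Perm n) p q → rk x p q ≡ rank x p q
rk≡rank {n} x p q = trans (length-filter-tabulate n _ (λ i → i))
  (sum-cong-≗ (λ i → χ-∧ (does (toℕ i <? p)) (does (val x i <? q))))

rank-resp-≐ : ∀ {n} (x x′ : Perm n) → x ≐ x′ → ∀ p q → rank x p q ≡ rank x′ p q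
rank-resp-≐ x x′ x≐x′ p q = sum-cong-≗ (λ i → cong (λ k → 𝟙< (toℕ i) p * 𝟙< (toℕ k) q) (x≐x′ i))

inversion : ∀ {n} → Perm n → Fin n → Fin n → ℕ
inversion x p q = 𝟙< (toℕ p) (toℕ q) * 𝟙< (val x q) (val x p)

inversions : ∀ {n} → Perm n → ℕ
inversions {n} x = ∑[ p < n ] ∑[ q < n ] inversion x p q

ℓ≡inversions : ∀ {n} (x : Perm n) → ℓ x ≡ inversions x
ℓ≡inversions {n} x = trans (length-filter-cartesianProduct n _ (λ i → i) (allFin n))
  (sum-cong-≗ (λ p → trans (length-filter-tabulate n _ (λ i → i))
    (sum-cong-≗ (λ q → χ-∧ (does (toℕ p <? toℕ q)) (does (val x q <? val x p))))))

ℓ-resp-≐ : ∀ {n} (x x′ : Perm n) → x ≐ x′ → ℓ x ≡ ℓ x′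
ℓ-resp-≐ x x′ x≐x′ = trans (ℓ≡inversions x) (trans same (sym (ℓ≡inversions x′)))
  where
  same : inversions x ≡ inversions x′
  same = sum-cong-≗ (λ p → sum-cong-≗ (λ q →
    cong₂ (λ s t → 𝟙< (toℕ p) (toℕ q) * 𝟙< s t) (cong toℕ (x≐x′ q)) (cong toℕ (x≐x′ p))))

rank-suc-row : ∀ {n} (x : Perm n) (k : Fin n) q → rank x (suc (toℕ k)) q ≡ rank x (toℕ k) q + 𝟙< (val x k) q
rank-suc-row {n} x k q = +-cancelʳ-≡ _ _ _ (begin
  rank x (suc (toℕ k)) q + 0
    ≡⟨ cong (λ t → rank x (suc (toℕ k)) q + t * 𝟙< (val x k) q) (𝟙<-irrefl (toℕ k)) ⟨
  rank x (suc (toℕ k)) q + 𝟙< (toℕ k) (toℕ k) * 𝟙< (val x k) q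
    ≡⟨ ∑-diff n k (λ i i≢k → cong (_* 𝟙< (val x i) q) (𝟙<-suc-≢ (λ e → i≢k (toℕ-injective e)))) ⟩
  rank x (toℕ k) q + 𝟙< (toℕ k) (suc (toℕ k)) * 𝟙< (val x k) q
    ≡⟨ cong (λ t → rank x (toℕ k) q + t * 𝟙< (val x k) q) (𝟙<-suc-self (toℕ k)) ⟩
  rank x (toℕ k) q + (𝟙< (val x k) q + 0)
    ≡⟨ +-assoc (rank x (toℕ k) q) _ 0 ⟨
  rank x (toℕ k) q + 𝟙< (val x k) q + 0 ∎)
  where open ≡-Reasoning

rank-suc-col : ∀ {n} (x : Perm n) p (j : Fin n) → rank x p (suc (toℕ j)) ≡ rank x p (toℕ j) + 𝟙< (pos x j) p
rank-suc-col {n} x p j = +-cancelʳ-≡ _ _ _ (begin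
  rank x p (suc (toℕ j)) + 0
    ≡⟨ cong (λ t → rank x p (suc (toℕ j)) + t) (*-zeroʳ (𝟙< (pos x j) p)) ⟨
  rank x p (suc (toℕ j)) + 𝟙< (pos x j) p * 0
    ≡⟨ cong (λ t → rank x p (suc (toℕ j)) + 𝟙< (pos x j) p * t) (trans (cong (λ v → 𝟙< v (toℕ j)) (val-pos x j)) (𝟙<-irrefl (toℕ j))) ⟨
  rank x p (suc (toℕ j)) + 𝟙< (pos x j) p * 𝟙< (val x k) (toℕ j)
    ≡⟨ ∑-diff n k (λ i i≢k → cong (𝟙< (toℕ i) p *_) (𝟙<-suc-≢ (λ e → i≢k (val-injective x (trans e (sym (val-pos x j))))))) ⟩
  rank x p (toℕ j) + 𝟙< (pos x j) p * 𝟙< (val x k) (suc (toℕ j))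
    ≡⟨ cong (λ t → rank x p (toℕ j) + 𝟙< (pos x j) p * t) (trans (cong (λ v → 𝟙< v (suc (toℕ j))) (val-pos x j)) (𝟙<-suc-self (toℕ j))) ⟩
  rank x p (toℕ j) + 𝟙< (pos x j) p * 1
    ≡⟨ cong (rank x p (toℕ j) +_) (*-identityʳ _) ⟩
  rank x p (toℕ j) + 𝟙< (pos x j) p
    ≡⟨ +-identityʳ _ ⟨
  rank x p (toℕ j) + 𝟙< (pos x j) p + 0 ∎)
  where
  open ≡-Reasoning
  k = x ⟨$⟩ˡ j

rank-suc-row-≥ : ∀ {n} (x : Perm n) p q → n ≤ p → rank x (suc p) q ≡ rank x p q
rank-suc-row-≥ {n} x p q n≤p = sum-cong-≗ (λ i → cong (_* 𝟙< (val x i) q)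
  (trans (𝟙<-yes (≤-trans (toℕ<n i) (m≤n⇒m≤1+n n≤p))) (sym (𝟙<-yes (≤-trans (toℕ<n i) n≤p)))))

rank-suc-col-≥ : ∀ {n} (x : Perm n) p q → n ≤ q → rank x p (suc q) ≡ rank x p q
rank-suc-col-≥ {n} x p q n≤q = sum-cong-≗ (λ i → cong (𝟙< (toℕ i) p *_)
  (trans (𝟙<-yes (≤-trans (toℕ<n (x ⟨$⟩ʳ i)) (m≤n⇒m≤1+n n≤q))) (sym (𝟙<-yes (≤-trans (toℕ<n (x ⟨$⟩ʳ i)) n≤q)))))

rank-zeroʳ : ∀ {n} (x : Perm n) p → rank x p 0 ≡ 0
rank-zeroʳ {n} x p = ∑-zero n (λ i → *-zeroʳ (𝟙< (toℕ i) p))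

rank-zeroˡ : ∀ {n} (x : Perm n) q → rank x 0 q ≡ 0
rank-zeroˡ {n} x q = ∑-zero n (λ i → refl)

+𝟙<-cases : ∀ r m n → (r + 𝟙< m n ≡ r) ⊎ (r + 𝟙< m n ≡ suc r)
+𝟙<-cases r m n with 𝟙<-dec m n
... | inj₁ (_ , e) = inj₂ (trans (cong (r +_) e) (+-comm r 1))
... | inj₂ (_ , e) = inj₁ (trans (cong (r +_) e) (+-identityʳ r))

rank-suc-row-cases : ∀ {n} (x : Perm n) p q → rank x (suc p) q ≡ rank x p q ⊎ rank x (suc p) q ≡ suc (rank x p q)
rank-suc-row-cases {n} x p q with p <? n
... | no p≮n = inj₁ (rank-suc-row-≥ x p q (≮⇒≥ p≮n))
... | yes p<n = subst (λ p → rank x (suc p) q ≡ rank x p q ⊎ rank x (suc p) q ≡ suc (rank x p q))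
  (toℕ-fromℕ< p<n) (⊎.map (trans (rank-suc-row x k q)) (trans (rank-suc-row x k q))
    (+𝟙<-cases (rank x (toℕ k) q) (val x k) q))
  where k = fromℕ< p<n

rank-suc-col-cases : ∀ {n} (x : Perm n) p q → rank x p (suc q) ≡ rank x p q ⊎ rank x p (suc q) ≡ suc (rank x p q)
rank-suc-col-cases {n} x p q with q <? n
... | no q≮n = inj₁ (rank-suc-col-≥ x p q (≮⇒≥ q≮n))
... | yes q<n = subst (λ q → rank x p (suc q) ≡ rank x p q ⊎ rank x p (suc q) ≡ suc (rank x p q))
  (toℕ-fromℕ< q<n) (⊎.map (trans (rank-suc-col x p j)) (trans (rank-suc-col x p j))
    (+𝟙<-cases (rank x p (toℕ j)) (pos x j) p))
  where j = fromℕ< q<n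

step-≤ : ∀ {s t} → s ≡ t ⊎ s ≡ suc t → t ≤ s × s ≤ suc t
step-≤ {t = t} (inj₁ refl) = ≤-refl , n≤1+n t
step-≤ {t = t} (inj₂ refl) = n≤1+n t , ≤-refl

rank-mono-row : ∀ {n} (x : Perm n) p q → rank x p q ≤ rank x (suc p) q
rank-mono-row x p q = proj₁ (step-≤ (rank-suc-row-cases x p q))

rank-suc-row-≤ : ∀ {n} (x : Perm n) p q → rank x (suc p) q ≤ suc (rank x p q)
rank-suc-row-≤ x p q = proj₂ (step-≤ (rank-suc-row-cases x p q))

rank-mono-col : ∀ {n} (x : Perm n) p q → rank x p q ≤ rank x p (suc q)
rank-mono-col x p q = proj₁ (step-≤ (rank-suc-col-cases x p q))

rank-suc-col-≤ : ∀ {n} (x : Perm n) p q → rank x p (suc q) ≤ suc (rank x p q)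
rank-suc-col-≤ x p q = proj₂ (step-≤ (rank-suc-col-cases x p q))

rank-transpose : ∀ {n} (x : Perm n) (i j : Fin n) → i ≢ j → ∀ p q →
  rank (x ·t[ i , j ]) p q + 𝟙< (toℕ i) p * 𝟙< (val x i) q + 𝟙< (toℕ j) p * 𝟙< (val x j) q
    ≡ rank x p q + 𝟙< (toℕ i) p * 𝟙< (val x j) q + 𝟙< (toℕ j) p * 𝟙< (val x i) q
rank-transpose {n} x i j i≢j p q =
  trans (∑-diff₂ n i j i≢j agree)
    (cong₂ (λ s t → rank x p q + 𝟙< (toℕ i) p * 𝟙< s q + 𝟙< (toℕ j) p * 𝟙< t q)
      (val-transpose-i x i j) (val-transpose-j x i j))
  where
  agree : ∀ l → l ≢ i → l ≢ j → 𝟙< (toℕ l) p * 𝟙< (val (x ·t[ i , j ]) l) q ≡ 𝟙< (toℕ l) p * 𝟙< (val x l) q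
  agree l l≢i l≢j = cong (λ v → 𝟙< (toℕ l) p * 𝟙< v q) (val-transpose-other x i j l l≢i l≢j)

between : ∀ {n} → Perm n → Fin n → Fin n → Fin n → ℕ
between x i j k = 𝟙< (toℕ i) (toℕ k) * 𝟙< (toℕ k) (toℕ j) * 𝟙< (val x i) (val x k) * 𝟙< (val x k) (val x j)

NoneBetween : ∀ {n} → Perm n → Fin n → Fin n → Set
NoneBetween {n} x i j = ∀ (k : Fin n) → toℕ i < toℕ k → toℕ k < toℕ j → val x i < val x k → val x k < val x j → ⊥

*-pos : ∀ a b → 0 < a * b → 0 < a × 0 < b
*-pos (suc a) (suc b) _ = s≤s z≤n , s≤s z≤n
*-pos (suc a) zero ab>0 rewrite *-zeroʳ a = ⊥-elim (<-irrefl refl ab>0)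

between-pos : ∀ {n} (x : Perm n) i j k → 0 < between x i j k →
  toℕ i < toℕ k × toℕ k < toℕ j × val x i < val x k × val x k < val x j
between-pos x i j k pos with *-pos _ _ pos
... | p₁₂₃ , p₄ with *-pos _ _ p₁₂₃
... | p₁₂ , p₃ with *-pos _ _ p₁₂
... | p₁ , p₂ = 𝟙<-pos p₁ , 𝟙<-pos p₂ , 𝟙<-pos p₃ , 𝟙<-pos p₄

between-one : ∀ {n} (x : Perm n) i j k → toℕ i < toℕ k → toℕ k < toℕ j → val x i < val x k → val x k < val x j →
  between x i j k ≡ 1
between-one x i j k ik kj xik xkj rewrite 𝟙<-yes ik | 𝟙<-yes kj | 𝟙<-yes xik | 𝟙<-yes xkj = refl

inversionsWith : ∀ {n} → Perm n → Fin n → Fin n → Fin n → ℕ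
inversionsWith x i j k = inversion x k i + inversion x k j + inversion x i k + inversion x j k

-- The truth table behind inversionsWith-transpose: with P = [k < i], Q = [k < j], U = [x k < x i],
-- W = [x k < x j], the only configuration whose count changes is k strictly between i and j in
-- both coordinates, which gains two inversions.
inversionsWith-table : ∀ P Q U W → (P ≡ true → Q ≡ true) → (U ≡ true → W ≡ true) →
  χ P * χ (not W) + χ Q * χ (not U) + χ (not P) * χ W + χ (not Q) * χ U
    ≡ χ P * χ (not U) + χ Q * χ (not W) + χ (not P) * χ U + χ (not Q) * χ W
      + (χ (not P) * χ Q * χ (not U) * χ W + χ (not P) * χ Q * χ (not U) * χ W)
inversionsWith-table true true true true _ _ = refl
inversionsWith-table true true true false _ U⇒W with U⇒W refl
... | ()
inversionsWith-table true true false true _ _ = refl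
inversionsWith-table true true false false _ _ = refl
inversionsWith-table true false _ _ P⇒Q _ with P⇒Q refl
... | ()
inversionsWith-table false true true true _ _ = refl
inversionsWith-table false true true false _ U⇒W with U⇒W refl
... | ()
inversionsWith-table false true false true _ _ = refl
inversionsWith-table false true false false _ _ = refl
inversionsWith-table false false true true _ _ = refl
inversionsWith-table false false true false _ U⇒W with U⇒W refl
... | ()
inversionsWith-table false false false true _ _ = refl
inversionsWith-table false false false false _ _ = refl

inversionsWith-transpose : ∀ {n} (x : Perm n) (i j k : Fin n) → toℕ i < toℕ j → val x i < val x j → k ≢ i → k ≢ j →
  inversionsWith (x ·t[ i , j ]) i j k ≡ inversionsWith x i j k + (between x i j k + between x i j k)
inversionsWith-transpose x i j k ij xij k≢i k≢j
  rewrite val-transpose-i x i j | val-transpose-j x i j | val-transpose-other x i j k k≢i k≢j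
        | 𝟙<-flip {toℕ k} {toℕ i} (λ e → k≢i (toℕ-injective e)) | 𝟙<-flip {toℕ k} {toℕ j} (λ e → k≢j (toℕ-injective e))
        | 𝟙<-flip {val x k} {val x i} (λ e → k≢i (val-injective x e)) | 𝟙<-flip {val x k} {val x j} (λ e → k≢j (val-injective x e))
  = inversionsWith-table (does (toℕ k <? toℕ i)) (does (toℕ k <? toℕ j)) (does (val x k <? val x i)) (does (val x k <? val x j))
      (λ e → <-does (<-trans (does-< e) ij)) (λ e → <-does (<-trans (does-< e) xij))

betweenCount : ∀ {n} → Perm n → Fin n → Fin n → ℕ
betweenCount {n} x i j = ∑[ k < n ] without i j (between x i j) k

inversions-transpose : ∀ {n} (x : Perm n) (i j : Fin n) → toℕ i < toℕ j → val x i < val x j →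
  inversions (x ·t[ i , j ]) ≡ suc (inversions x + (betweenCount x i j + betweenCount x i j))
inversions-transpose {n} x i j ij xij =
  trans (∑∑-split₂ n i j i≢j (inversion y))
  (trans (cong₂ _+_ (cong₂ _+_ corners withIJ) rest)
  (trans (regroup (∑[ k < n ] without i j (inversionsWith x i j) k) (∑[ k < n ] without i j (λ p → ∑[ q < n ] without i j (inversion x p) q) k) M)
  (cong (λ t → suc (t + (M + M))) (sym (trans (∑∑-split₂ n i j i≢j (inversion x))
    (cong (λ t → t + ∑[ k < n ] without i j (inversionsWith x i j) k + ∑[ k < n ] without i j (λ p → ∑[ q < n ] without i j (inversion x p) q) k) cornersₓ))))))
  where
  y = x ·t[ i , j ]
  M = betweenCount x i j
  i≢j : i ≢ j
  i≢j e = <-irrefl (cong toℕ e) ij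
  corners : inversion y i i + inversion y j i + inversion y i j + inversion y j j ≡ 1
  corners rewrite 𝟙<-irrefl (toℕ i) | 𝟙<-irrefl (toℕ j) | 𝟙<-no {toℕ j} {toℕ i} (<-asym ij) | 𝟙<-yes ij
                | val-transpose-i x i j | val-transpose-j x i j | 𝟙<-yes xij = refl
  cornersₓ : inversion x i i + inversion x j i + inversion x i j + inversion x j j ≡ 0
  cornersₓ rewrite 𝟙<-irrefl (toℕ i) | 𝟙<-irrefl (toℕ j) | 𝟙<-no {toℕ j} {toℕ i} (<-asym ij) | 𝟙<-yes ij
                 | 𝟙<-no {val x j} {val x i} (<-asym xij) = refl
  withIJ : ∑[ k < n ] without i j (inversionsWith y i j) k ≡ ∑[ k < n ] without i j (inversionsWith x i j) k + (M + M)
  withIJ = begin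
    ∑[ k < n ] without i j (inversionsWith y i j) k
      ≡⟨ sum-cong-≗ (without-cong i j _ _ (λ k k≢i k≢j → inversionsWith-transpose x i j k ij xij k≢i k≢j)) ⟩
    ∑[ k < n ] without i j (λ k → inversionsWith x i j k + (between x i j k + between x i j k)) k
      ≡⟨ sum-cong-≗ (λ l → trans (without-+ i j (inversionsWith x i j) (λ k → between x i j k + between x i j k) l)
                               (cong (without i j (inversionsWith x i j) l +_) (without-+ i j (between x i j) (between x i j) l))) ⟩
    ∑[ k < n ] (without i j (inversionsWith x i j) k + (without i j (between x i j) k + without i j (between x i j) k))
      ≡⟨ ∑-distrib-+ (without i j (inversionsWith x i j)) (λ l → without i j (between x i j) l + without i j (between x i j) l) ⟩
    ∑[ k < n ] without i j (inversionsWith x i j) k + ∑[ k < n ] (without i j (between x i j) k + without i j (between x i j) k)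
      ≡⟨ cong (∑[ k < n ] without i j (inversionsWith x i j) k +_) (∑-distrib-+ (without i j (between x i j)) (without i j (between x i j))) ⟩
    ∑[ k < n ] without i j (inversionsWith x i j) k + (M + M) ∎
    where open ≡-Reasoning
  rest : ∑[ p < n ] without i j (λ p → ∑[ q < n ] without i j (inversion y p) q) p
       ≡ ∑[ p < n ] without i j (λ p → ∑[ q < n ] without i j (inversion x p) q) p
  rest = sum-cong-≗ (without-cong i j _ _ (λ p p≢i p≢j → sum-cong-≗ (without-cong i j _ _ (λ q q≢i q≢j →
           cong₂ (λ s t → 𝟙< (toℕ p) (toℕ q) * 𝟙< s t) (val-transpose-other x i j q q≢i q≢j) (val-transpose-other x i j p p≢i p≢j)))))
  regroup : ∀ a b m → 1 + (a + (m + m)) + b ≡ suc (0 + a + b + (m + m))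
  regroup = solve-∀

betweenCount≡0 : ∀ {n} (x : Perm n) (i j : Fin n) → NoneBetween x i j → betweenCount x i j ≡ 0
betweenCount≡0 {n} x i j none = ∑-zero n (λ l → n≤0⇒n≡0 (≮⇒≥ (λ pos → absurd l pos)))
  where
  absurd : ∀ l → 0 < without i j (between x i j) l → ⊥
  absurd l pos with without-pos i j (between x i j) l pos
  ... | _ , _ , b>0 with between-pos x i j l b>0
  ... | il , lj , xil , xlj = none l il lj xil xlj

ℓ-transpose-cover : ∀ {n} (x : Perm n) (i j : Fin n) → toℕ i < toℕ j → val x i < val x j → NoneBetween x i j →
  ℓ (x ·t[ i , j ]) ≡ suc (ℓ x)
ℓ-transpose-cover x i j ij xij none = begin
  ℓ (x ·t[ i , j ])         ≡⟨ ℓ≡inversions (x ·t[ i , j ]) ⟩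
  inversions (x ·t[ i , j ]) ≡⟨ inversions-transpose x i j ij xij ⟩
  suc (inversions x + (M + M)) ≡⟨ cong (λ m → suc (inversions x + (m + m))) (betweenCount≡0 x i j none) ⟩
  suc (inversions x + 0)      ≡⟨ cong suc (trans (+-identityʳ _) (sym (ℓ≡inversions x))) ⟩
  suc (ℓ x)                   ∎
  where
  open ≡-Reasoning
  M = betweenCount x i j

ℓ-transpose-suc⇒NoneBetween : ∀ {n} (x : Perm n) (i j : Fin n) → toℕ i < toℕ j → val x i < val x j →
  ℓ (x ·t[ i , j ]) ≡ suc (ℓ x) → NoneBetween x i j
ℓ-transpose-suc⇒NoneBetween {n} x i j ij xij ℓ-suc k ik kj xik xkj =
  1≢0 (trans (sym one) (n≤0⇒n≡0 (≤-trans (∑-≥ n _ k) (≤-reflexive M≡0))))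
  where
  1≢0 : ¬ (1 ≡ 0)
  1≢0 ()
  M = betweenCount x i j
  one : without i j (between x i j) k ≡ 1
  one = trans (without-other i j _ k (λ e → <-irrefl (cong toℕ (sym e)) ik) (λ e → <-irrefl (cong toℕ e) kj))
              (between-one x i j k ik kj xik xkj)
  suc-eq : suc (inversions x + (M + M)) ≡ suc (inversions x)
  suc-eq = trans (sym (inversions-transpose x i j ij xij))
             (trans (sym (ℓ≡inversions (x ·t[ i , j ]))) (trans ℓ-suc (cong suc (ℓ≡inversions x))))
  M≡0 : M ≡ 0
  M≡0 = m+n≡0⇒m≡0 _ (+-cancelˡ-≡ (inversions x) _ _ (trans (suc-injective suc-eq) (sym (+-identityʳ _))))

-- Corner sums of matrices

[]≡χ : ∀ {P : Set} (d : Dec P) → [ d ] ≡ +ᶻ χ (does d)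
[]≡χ (yes _) = refl
[]≡χ (no _) = refl

Σℤ-cong : ∀ n {f g : Fin n → ℤ} → (∀ i → f i ≡ g i) → Σℤ n f ≡ Σℤ n g
Σℤ-cong zero _ = refl
Σℤ-cong (suc n) f≗g = cong₂ _+ᶻ_ (f≗g zero) (Σℤ-cong n (λ i → f≗g (suc i)))

Σℤ-zero : ∀ n {g : Fin n → ℤ} → (∀ i → g i ≡ +ᶻ 0) → Σℤ n g ≡ +ᶻ 0
Σℤ-zero zero _ = refl
Σℤ-zero (suc n) g≡0 = cong₂ _+ᶻ_ (g≡0 zero) (Σℤ-zero n (λ i → g≡0 (suc i)))

Σℤ-*ˡ : ∀ n (c : ℤ) (f : Fin n → ℤ) → Σℤ n (λ j → c *ᶻ f j) ≡ c *ᶻ Σℤ n f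
Σℤ-*ˡ zero c f = sym (ℤ.*-zeroʳ c)
Σℤ-*ˡ (suc n) c f = trans (cong (_+ᶻ_ (c *ᶻ f zero)) (Σℤ-*ˡ n c (λ i → f (suc i)))) (sym (ℤ.*-distribˡ-+ c (f zero) _))

Σℤ-+ : ∀ n (f : Fin n → ℕ) → Σℤ n (λ i → +ᶻ f i) ≡ +ᶻ ∑[ i < n ] f i
Σℤ-+ zero f = refl
Σℤ-+ (suc n) f = trans (cong (_+ᶻ_ (+ᶻ f zero)) (Σℤ-+ n (λ i → f (suc i)))) (sym (ℤ.pos-+ (f zero) _))

Σℤ-𝟙<-zero : ∀ n (g : Fin n → ℤ) → Σℤ n (λ i → +ᶻ 𝟙< (toℕ i) 0 *ᶻ g i) ≡ +ᶻ 0
Σℤ-𝟙<-zero zero g = refl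
Σℤ-𝟙<-zero (suc n) g = trans (ℤ.+-identityˡ _) (Σℤ-𝟙<-zero n (λ i → g (suc i)))

rkM-iterated : ∀ {n} (M : Matrix n) p q →
  rkM M p q ≡ Σℤ n (λ i → +ᶻ 𝟙< (toℕ i) p *ᶻ Σℤ n (λ j → +ᶻ 𝟙< (toℕ j) q *ᶻ M i j))
rkM-iterated {n} M p q = Σℤ-cong n (λ i → trans (Σℤ-cong n (λ j →
    trans (cong₂ (λ s t → s *ᶻ t *ᶻ M i j) ([]≡χ (toℕ i <? p)) ([]≡χ (toℕ j <? q))) (ℤ.*-assoc (+ᶻ 𝟙< (toℕ i) p) _ _)))
  (Σℤ-*ˡ n (+ᶻ 𝟙< (toℕ i) p) (λ j → +ᶻ 𝟙< (toℕ j) q *ᶻ M i j)))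

Σℤ-telescope : ∀ n p (h : ℕ → ℤ) → Σℤ n (λ i → +ᶻ 𝟙< (toℕ i) p *ᶻ (h (suc (toℕ i)) -ᶻ h (toℕ i))) ≡ h (p ⊓ n) -ᶻ h 0
Σℤ-telescope zero p h rewrite ⊓-zeroʳ p = sym (ℤ.+-inverseʳ (h 0))
Σℤ-telescope (suc n) zero h = trans (Σℤ-𝟙<-zero (suc n) (λ i → h (suc (toℕ i)) -ᶻ h (toℕ i))) (sym (ℤ.+-inverseʳ (h 0)))
Σℤ-telescope (suc n) (suc p) h =
  trans (cong₂ _+ᶻ_ (ℤ.*-identityˡ (h 1 -ᶻ h 0)) (Σℤ-telescope n p (λ c → h (suc c)))) (chain (h 0) (h 1) (h (suc (p ⊓ n))))
  where
  chain : ∀ a b c → (b -ᶻ a) +ᶻ (c -ᶻ b) ≡ c -ᶻ a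
  chain = ℤ-Solver.solve-∀

rkM-permMatrix : ∀ {n} (x : Perm n) p q → rkM (permMatrix x) p q ≡ +ᶻ rank x p q
rkM-permMatrix {n} x p q = trans (rkM-iterated (permMatrix x) p q)
  (trans (Σℤ-cong n (λ i → trans (cong (+ᶻ 𝟙< (toℕ i) p *ᶻ_)
      (trans (Σℤ-cong n (λ j → cong (+ᶻ 𝟙< (toℕ j) q *ᶻ_) ([]≡χ (x ⟨$⟩ʳ i ≟F j)))) (row-sum n (x ⟨$⟩ʳ i) q)))
    (sym (ℤ.pos-* (𝟙< (toℕ i) p) (𝟙< (val x i) q)))))
  (Σℤ-+ n (λ i → 𝟙< (toℕ i) p * 𝟙< (val x i) q)))
  where
  row-sum : ∀ n (k : Fin n) q → Σℤ n (λ j → +ᶻ 𝟙< (toℕ j) q *ᶻ +ᶻ χ (does (k ≟F j))) ≡ +ᶻ 𝟙< (toℕ k) q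
  row-sum n k zero = Σℤ-𝟙<-zero n (λ j → +ᶻ χ (does (k ≟F j)))
  row-sum (suc n) zero (suc q) = cong (_+ᶻ_ (+ᶻ 1)) (Σℤ-zero n (λ j → ℤ.*-zeroʳ (+ᶻ 𝟙< (suc (toℕ j)) (suc q))))
  row-sum (suc n) (suc k) (suc q) = trans (ℤ.+-identityˡ _) (row-sum n k q)

rkM-⊓ : ∀ {n} (A : Matrix n) p q → rkM A (p ⊓ n) (q ⊓ n) ≡ rkM A p q
rkM-⊓ {n} A p q = trans (rkM-iterated A (p ⊓ n) (q ⊓ n))
  (trans (Σℤ-cong n (λ i → cong₂ (λ s t → +ᶻ s *ᶻ t) (𝟙<-⊓ p (toℕ<n i))
                          (Σℤ-cong n (λ j → cong (λ s → +ᶻ s *ᶻ A i j) (𝟙<-⊓ q (toℕ<n j))))))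
  (sym (rkM-iterated A p q)))
  where
  𝟙<-⊓ : ∀ {m n} p → m < n → 𝟙< m (p ⊓ n) ≡ 𝟙< m p
  𝟙<-⊓ {m} {n} p m<n with 𝟙<-dec m (p ⊓ n) | 𝟙<-dec m p
  ... | inj₁ (_ , e) | inj₁ (_ , e′) = trans e (sym e′)
  ... | inj₂ (_ , e) | inj₂ (_ , e′) = trans e (sym e′)
  ... | inj₁ (m<p⊓n , _) | inj₂ (m≮p , _) = ⊥-elim (m≮p (≤-trans m<p⊓n (m⊓n≤m p n)))
  ... | inj₂ (m≮p⊓n , _) | inj₁ (m<p , _) = ⊥-elim (m≮p⊓n (⊓-glb m<p m<n))

rkM-zeroʳ : ∀ {n} (A : Matrix n) p → rkM A p 0 ≡ +ᶻ 0
rkM-zeroʳ {n} A p = trans (rkM-iterated A p 0)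
  (Σℤ-zero n (λ i → trans (cong (_*ᶻ_ (+ᶻ 𝟙< (toℕ i) p)) (Σℤ-𝟙<-zero n (A i))) (ℤ.*-zeroʳ (+ᶻ 𝟙< (toℕ i) p))))

rkM-zeroˡ : ∀ {n} (A : Matrix n) q → rkM A 0 q ≡ +ᶻ 0
rkM-zeroˡ {n} A q = trans (rkM-iterated A 0 q) (Σℤ-𝟙<-zero n (λ i → Σℤ n (λ j → +ᶻ 𝟙< (toℕ j) q *ᶻ A i j)))

rkM-∨ : ∀ {n} (A B : Matrix n) p q → rkM (A ∨ B) p q ≡ rkM A p q ⊓ᶻ rkM B p q
rkM-∨ {n} A B p q =
  trans (rkM-iterated (A ∨ B) p q)
  (trans (Σℤ-cong n (λ i → cong (+ᶻ 𝟙< (toℕ i) p *ᶻ_)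
     (trans (Σℤ-cong n (λ j → cong (+ᶻ 𝟙< (toℕ j) q *ᶻ_) (entry i j))) (trans (Σℤ-telescope n q (H i)) (H-ends i)))))
  (trans (Σℤ-telescope n p G)
  (trans (cong (G (p ⊓ n) -ᶻ_) (cong₂ _⊓ᶻ_ (rkM-zeroˡ A (q ⊓ n)) (rkM-zeroˡ B (q ⊓ n))))
  (trans (ℤ.+-identityʳ (G (p ⊓ n))) (cong₂ _⊓ᶻ_ (rkM-⊓ A p q) (rkM-⊓ B p q))))))
  where
  r : ℕ → ℕ → ℤ
  r s t = rkM A s t ⊓ᶻ rkM B s t
  H : Fin n → ℕ → ℤ
  H i t = r (suc (toℕ i)) t -ᶻ r (toℕ i) t
  G : ℕ → ℤ
  G s = r s (q ⊓ n)
  regroup : ∀ a b c d → a -ᶻ b -ᶻ c +ᶻ d ≡ (a -ᶻ b) -ᶻ (c -ᶻ d)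
  regroup = ℤ-Solver.solve-∀
  entry : ∀ i j → (A ∨ B) i j ≡ H i (suc (toℕ j)) -ᶻ H i (toℕ j)
  entry i j = regroup (r (suc (toℕ i)) (suc (toℕ j))) (r (toℕ i) (suc (toℕ j))) (r (suc (toℕ i)) (toℕ j)) (r (toℕ i) (toℕ j))
  H-ends : ∀ i → H i (q ⊓ n) -ᶻ H i 0 ≡ G (suc (toℕ i)) -ᶻ G (toℕ i)
  H-ends i rewrite rkM-zeroʳ A (suc (toℕ i)) | rkM-zeroʳ B (suc (toℕ i)) | rkM-zeroʳ A (toℕ i) | rkM-zeroʳ B (toℕ i)
    = ℤ.+-identityʳ (G (suc (toℕ i)) -ᶻ G (toℕ i))

≥M-resp-≐ : ∀ {n} (x x′ : Perm n) {M : Matrix n} → x ≐ x′ → x ≥M M → x′ ≥M M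
≥M-resp-≐ x x′ {M} x≐x′ x≥M p q = subst (_≤ᶻ rkM M p q) same (x≥M p q)
  where
  same : rkM (permMatrix x) p q ≡ rkM (permMatrix x′) p q
  same = trans (rkM-permMatrix x p q) (trans (cong +ᶻ_ (rank-resp-≐ x x′ x≐x′ p q)) (sym (rkM-permMatrix x′ p q)))

_≼_ : ∀ {n} → Perm n → Perm n → Set
x ≼ u = ∀ p q → rank u p q ≤ rank x p q

≤B⇔≼ : ∀ {n} (x u : Perm n) → x ≤B u ⇔ x ≼ u
≤B⇔≼ x u = mk⇔ (λ x≤u p q → subst₂ _≤_ (rk≡rank u p q) (rk≡rank x p q) (x≤u p q))
               (λ x≼u p q → subst₂ _≤_ (sym (rk≡rank u p q)) (sym (rk≡rank x p q)) (x≼u p q))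

≥M-∨⇔ : ∀ {n} (u v π : Perm n) → u ≥M (permMatrix v ∨ permMatrix π) ⇔ (v ≼ u × π ≼ u)
≥M-∨⇔ u v π = mk⇔ (λ u≥ → (λ p q → bounded v p q u≥ (ℤ.i⊓j≤i _ _)) , (λ p q → bounded π p q u≥ (ℤ.i⊓j≤j _ _))) above
  where
  J = permMatrix v ∨ permMatrix π
  bounded : ∀ x p q → u ≥M J → rkM (permMatrix v) p q ⊓ᶻ rkM (permMatrix π) p q ≤ᶻ rkM (permMatrix x) p q →
    rank u p q ≤ rank x p q
  bounded x p q u≥ meet≤x = ℤ.drop‿+≤+ (begin
    +ᶻ rank u p q                                     ≡⟨ rkM-permMatrix u p q ⟨
    rkM (permMatrix u) p q                           ≤⟨ u≥ p q ⟩
    rkM J p q                                        ≡⟨ rkM-∨ (permMatrix v) (permMatrix π) p q ⟩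
    rkM (permMatrix v) p q ⊓ᶻ rkM (permMatrix π) p q ≤⟨ meet≤x ⟩
    rkM (permMatrix x) p q                           ≡⟨ rkM-permMatrix x p q ⟩
    +ᶻ rank x p q                                     ∎)
    where open ℤ.≤-Reasoning
  above : v ≼ u × π ≼ u → u ≥M J
  above (v≼u , π≼u) p q = begin
    rkM (permMatrix u) p q                           ≡⟨ rkM-permMatrix u p q ⟩
    +ᶻ rank u p q                                     ≤⟨ ℤ.⊓-glb (+≤+ (v≼u p q)) (+≤+ (π≼u p q)) ⟩
    +ᶻ rank v p q ⊓ᶻ +ᶻ rank π p q                     ≡⟨ cong₂ _⊓ᶻ_ (rkM-permMatrix v p q) (rkM-permMatrix π p q) ⟨
    rkM (permMatrix v) p q ⊓ᶻ rkM (permMatrix π) p q ≡⟨ rkM-∨ (permMatrix v) (permMatrix π) p q ⟨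
    rkM J p q                                        ∎
    where open ℤ.≤-Reasoning

-- Fulton's essential set criterion

decideAt : ∀ {n} (P : Fin n → Set) → (∀ i → Dec (P i)) → (m : ℕ) →
  (Σ (Fin n) λ i → toℕ i ≡ m × P i) ⊎ (∀ i → toℕ i ≡ m → ¬ P i)
decideAt {n} P P? m with m <? n
... | no m≮n = inj₂ (λ i e _ → m≮n (subst (_< n) e (toℕ<n i)))
... | yes m<n with P? (fromℕ< m<n)
...   | yes p = inj₁ (fromℕ< m<n , toℕ-fromℕ< m<n , p)
...   | no ¬p = inj₂ (λ i e p → ¬p (subst P (toℕ-injective (trans e (sym (toℕ-fromℕ< m<n)))) p))

InD? : ∀ {n} (x : Perm n) i j → Dec (InD x i j)
InD? x i j with toℕ j <? toℕ (x ⟨$⟩ʳ i) | toℕ i <? toℕ (x ⟨$⟩ˡ j)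
... | yes j<xi | yes i<x⁻¹j = yes (j<xi , i<x⁻¹j)
... | no j≮xi | _ = no (λ d → j≮xi (proj₁ d))
... | yes _ | no i≮x⁻¹j = no (λ d → i≮x⁻¹j (proj₂ d))

RankBoundedOnEss : ∀ {n} → Perm n → Perm n → Set
RankBoundedOnEss {n} π u =
  ∀ (e f : Fin n) → InEss π e f → rank u (suc (toℕ e)) (suc (toℕ f)) ≤ rank π (suc (toℕ e)) (suc (toℕ f))

distanceToCorner : ∀ {n} → Fin n → Fin n → ℕ
distanceToCorner {n} e f = (n ∸ toℕ e) + (n ∸ toℕ f)

-- From a diagram cell, walk down or right inside D(π) until an essential cell is reached; along the way
-- rk_π stays constant while rk_u can only grow.
rank-bounded-on-D : ∀ {n} (π u : Perm n) → RankBoundedOnEss π u → ∀ N (e f : Fin n) →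
  distanceToCorner e f ≤ N → InD π e f → rank u (suc (toℕ e)) (suc (toℕ f)) ≤ rank π (suc (toℕ e)) (suc (toℕ f))
rank-bounded-on-D {n} π u bounded zero e f dist≤0 _ =
  ⊥-elim (<-irrefl refl (≤-trans (toℕ<n e) (m∸n≡0⇒m≤n {n} {toℕ e} (m+n≡0⇒m≡0 _ (n≤0⇒n≡0 dist≤0)))))
rank-bounded-on-D {n} π u bounded (suc N) e f dist≤ d
  with decideAt (λ i → InD π i f) (λ i → InD? π i f) (suc (toℕ e))
... | inj₁ (e′ , e′≡ , d′) = begin
  rank u (suc (toℕ e)) (suc (toℕ f))   ≤⟨ subst (λ r → rank u (suc (toℕ e)) (suc (toℕ f)) ≤ rank u r (suc (toℕ f))) (cong suc (sym e′≡))
                                            (rank-mono-row u (suc (toℕ e)) (suc (toℕ f))) ⟩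
  rank u (suc (toℕ e′)) (suc (toℕ f))  ≤⟨ rank-bounded-on-D π u bounded N e′ f (closer-row e′≡) d′ ⟩
  rank π (suc (toℕ e′)) (suc (toℕ f))  ≡⟨ trans (rank-suc-row π e′ (suc (toℕ f))) (cong₂ _+_ (cong (λ r → rank π r (suc (toℕ f))) e′≡)
                                            (𝟙<-no (λ v<f+1 → <-irrefl refl (≤-trans (proj₁ d′) (≤-pred v<f+1))))) ⟩
  rank π (suc (toℕ e)) (suc (toℕ f)) + 0 ≡⟨ +-identityʳ _ ⟩
  rank π (suc (toℕ e)) (suc (toℕ f))   ∎
  where
  open ≤-Reasoning
  closer-row : toℕ e′ ≡ suc (toℕ e) → distanceToCorner e′ f ≤ N
  closer-row e′≡ = ≤-pred (≤-trans (+-monoˡ-< (n ∸ toℕ f) (∸-monoʳ-< (≤-reflexive (sym e′≡)) (<⇒≤ (toℕ<n e′)))) dist≤)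
... | inj₂ not-below with decideAt (λ j → InD π e j) (λ j → InD? π e j) (suc (toℕ f))
...   | inj₁ (f′ , f′≡ , d′) = begin
  rank u (suc (toℕ e)) (suc (toℕ f))   ≤⟨ subst (λ c → rank u (suc (toℕ e)) (suc (toℕ f)) ≤ rank u (suc (toℕ e)) c) (cong suc (sym f′≡))
                                            (rank-mono-col u (suc (toℕ e)) (suc (toℕ f))) ⟩
  rank u (suc (toℕ e)) (suc (toℕ f′))  ≤⟨ rank-bounded-on-D π u bounded N e f′ closer-col d′ ⟩
  rank π (suc (toℕ e)) (suc (toℕ f′))  ≡⟨ trans (rank-suc-col π (suc (toℕ e)) f′) (cong₂ _+_ (cong (rank π (suc (toℕ e))) f′≡)
                                            (𝟙<-no (λ p<e+1 → <-irrefl refl (≤-trans (proj₂ d′) (≤-pred p<e+1))))) ⟩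
  rank π (suc (toℕ e)) (suc (toℕ f)) + 0 ≡⟨ +-identityʳ _ ⟩
  rank π (suc (toℕ e)) (suc (toℕ f))   ∎
  where
  open ≤-Reasoning
  closer-col : distanceToCorner e f′ ≤ N
  closer-col = ≤-pred (≤-trans (+-monoʳ-< (n ∸ toℕ e) (∸-monoʳ-< (≤-reflexive (sym f′≡)) (<⇒≤ (toℕ<n f′)))) dist≤)
...   | inj₂ not-right = bounded e f (d , not-below , not-right)

+𝟙<≤⇒≮ : ∀ {r m t} → r + 𝟙< m t ≤ r → ¬ (m < t)
+𝟙<≤⇒≮ {r} m<t≤ m<t = <-irrefl refl (≤-trans (≤-reflexive (trans (+-comm 1 r) (cong (r +_) (sym (𝟙<-yes m<t))))) m<t≤)

rank-bound-step : ∀ {n} (π u : Perm n) → RankBoundedOnEss π u → (k j : Fin n) →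
  rank u (toℕ k) (suc (toℕ j)) ≤ rank π (toℕ k) (suc (toℕ j)) →
  rank u (suc (toℕ k)) (toℕ j) ≤ rank π (suc (toℕ k)) (toℕ j) →
  rank u (suc (toℕ k)) (suc (toℕ j)) ≤ rank π (suc (toℕ k)) (suc (toℕ j))
rank-bound-step π u bounded k j above left with rank u (suc (toℕ k)) (suc (toℕ j)) ≤? rank π (suc (toℕ k)) (suc (toℕ j))
... | yes ok = ok
... | no bad = ⊥-elim (bad (rank-bounded-on-D π u bounded _ k j ≤-refl (row-in-D , col-in-D)))
  where
  π<u : rank π (suc (toℕ k)) (suc (toℕ j)) < rank u (suc (toℕ k)) (suc (toℕ j))
  π<u = ≰⇒> bad
  open ≤-Reasoning
  row-in-D : toℕ j < val π k
  row-in-D = ≮⇒≥ (+𝟙<≤⇒≮ (≤-pred (begin-strict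
    rank π (toℕ k) (suc (toℕ j)) + 𝟙< (val π k) (suc (toℕ j)) ≡⟨ rank-suc-row π k (suc (toℕ j)) ⟨
    rank π (suc (toℕ k)) (suc (toℕ j))                         <⟨ π<u ⟩
    rank u (suc (toℕ k)) (suc (toℕ j))                         ≤⟨ rank-suc-row-≤ u (toℕ k) (suc (toℕ j)) ⟩
    suc (rank u (toℕ k) (suc (toℕ j)))                         ≤⟨ s≤s above ⟩
    suc (rank π (toℕ k) (suc (toℕ j)))                         ∎)))
  col-in-D : toℕ k < pos π j
  col-in-D = ≮⇒≥ (+𝟙<≤⇒≮ (≤-pred (begin-strict
    rank π (suc (toℕ k)) (toℕ j) + 𝟙< (pos π j) (suc (toℕ k)) ≡⟨ rank-suc-col π (suc (toℕ k)) j ⟨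
    rank π (suc (toℕ k)) (suc (toℕ j))                         <⟨ π<u ⟩
    rank u (suc (toℕ k)) (suc (toℕ j))                         ≤⟨ rank-suc-col-≤ u (suc (toℕ k)) (toℕ j) ⟩
    suc (rank u (suc (toℕ k)) (toℕ j))                         ≤⟨ s≤s left ⟩
    suc (rank π (suc (toℕ k)) (toℕ j))                         ∎)))

essential-set-criterion : ∀ {n} (π u : Perm n) → RankBoundedOnEss π u → π ≼ u
essential-set-criterion π u bounded zero q = subst (_≤ rank π 0 q) (sym (rank-zeroˡ u q)) z≤n
essential-set-criterion π u bounded (suc p) zero = subst (_≤ rank π (suc p) 0) (sym (rank-zeroʳ u (suc p))) z≤n
essential-set-criterion {n} π u bounded (suc p) (suc q) with p <? n | q <? n
... | no p≮n | _ = subst₂ _≤_ (sym (rank-suc-row-≥ u p (suc q) (≮⇒≥ p≮n))) (sym (rank-suc-row-≥ π p (suc q) (≮⇒≥ p≮n)))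
                     (essential-set-criterion π u bounded p (suc q))
... | yes _ | no q≮n = subst₂ _≤_ (sym (rank-suc-col-≥ u (suc p) q (≮⇒≥ q≮n))) (sym (rank-suc-col-≥ π (suc p) q (≮⇒≥ q≮n)))
                         (essential-set-criterion π u bounded (suc p) q)
... | yes p<n | yes q<n
  with essential-set-criterion π u bounded p (suc q) | essential-set-criterion π u bounded (suc p) q
     | fromℕ< p<n | toℕ-fromℕ< p<n | fromℕ< q<n | toℕ-fromℕ< q<n
...   | above | left | k | refl | j | refl = rank-bound-step π u bounded k j above left

-- Transpositions, rectangles and Bruhat covers

InRectangle : ℕ → ℕ → ℕ → ℕ → ℕ → ℕ → Set
InRectangle i a α β p q = i < p × ¬ (a < p) × α < q × ¬ (β < q)

InRectangle? : ∀ i a α β p q → Dec (InRectangle i a α β p q)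
InRectangle? i a α β p q = (i <? p) ×-dec ¬? (a <? p) ×-dec (α <? q) ×-dec ¬? (β <? q)

rectangle : ℕ → ℕ → ℕ → ℕ → ℕ → ℕ → ℕ
rectangle i a α β p q = χ (does (InRectangle? i a α β p q))

rectangle-table : ∀ P₁ P₂ Q₁ Q₂ → (P₂ ≡ true → P₁ ≡ true) → (Q₂ ≡ true → Q₁ ≡ true) →
  χ P₁ * χ Q₂ + χ P₂ * χ Q₁ + χ (P₁ ∧ not P₂ ∧ Q₁ ∧ not Q₂) ≡ χ P₁ * χ Q₁ + χ P₂ * χ Q₂
rectangle-table true true true true _ _ = refl
rectangle-table true true true false _ _ = refl
rectangle-table true true false true _ Q₂⇒Q₁ with Q₂⇒Q₁ refl
... | ()
rectangle-table true true false false _ _ = refl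
rectangle-table true false true true _ _ = refl
rectangle-table true false true false _ _ = refl
rectangle-table true false false true _ Q₂⇒Q₁ with Q₂⇒Q₁ refl
... | ()
rectangle-table true false false false _ _ = refl
rectangle-table false true _ _ P₂⇒P₁ _ with P₂⇒P₁ refl
... | ()
rectangle-table false false true true _ _ = refl
rectangle-table false false true false _ _ = refl
rectangle-table false false false true _ Q₂⇒Q₁ with Q₂⇒Q₁ refl
... | ()
rectangle-table false false false false _ _ = refl

rank-transpose-rectangle : ∀ {n} (x : Perm n) (i a : Fin n) → toℕ i < toℕ a → val x i < val x a → ∀ p q →
  rank (x ·t[ i , a ]) p q + rectangle (toℕ i) (toℕ a) (val x i) (val x a) p q ≡ rank x p q
rank-transpose-rectangle x i a ia xia p q = +-cancelʳ-≡ off _ _ (begin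
  rank y p q + box + off   ≡⟨ +-assoc (rank y p q) box off ⟩
  rank y p q + (box + off) ≡⟨ cong (rank y p q +_) (trans (+-comm box off) table) ⟩
  rank y p q + on          ≡⟨ +-assoc (rank y p q) _ _ ⟨
  rank y p q + 𝟙< (toℕ i) p * 𝟙< (val x i) q + 𝟙< (toℕ a) p * 𝟙< (val x a) q
                           ≡⟨ rank-transpose x i a (λ e → <-irrefl (cong toℕ e) ia) p q ⟩
  rank x p q + 𝟙< (toℕ i) p * 𝟙< (val x a) q + 𝟙< (toℕ a) p * 𝟙< (val x i) q
                           ≡⟨ +-assoc (rank x p q) _ _ ⟩
  rank x p q + off         ∎)
  where
  open ≡-Reasoning
  y = x ·t[ i , a ]
  box = rectangle (toℕ i) (toℕ a) (val x i) (val x a) p q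
  off = 𝟙< (toℕ i) p * 𝟙< (val x a) q + 𝟙< (toℕ a) p * 𝟙< (val x i) q
  on = 𝟙< (toℕ i) p * 𝟙< (val x i) q + 𝟙< (toℕ a) p * 𝟙< (val x a) q
  table : off + box ≡ on
  table = rectangle-table (does (toℕ i <? p)) (does (toℕ a <? p)) (does (val x i <? q)) (does (val x a <? q))
    (λ e → <-does (<-trans ia (does-< {toℕ a} {p} e))) (λ e → <-does (<-trans xia (does-< {val x a} {q} e)))

rectangle-yes : ∀ {i a α β p q} → InRectangle i a α β p q → rectangle i a α β p q ≡ 1
rectangle-yes {i} {a} {α} {β} {p} {q} r = cong χ (dec-true (InRectangle? i a α β p q) r)

rectangle-no : ∀ {i a α β p q} → ¬ InRectangle i a α β p q → rectangle i a α β p q ≡ 0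
rectangle-no {i} {a} {α} {β} {p} {q} ¬r = cong χ (dec-false (InRectangle? i a α β p q) ¬r)

𝟙<-injective : ∀ {m m′} → (∀ q → 𝟙< m q ≡ 𝟙< m′ q) → m ≡ m′
𝟙<-injective {m} {m′} same = ≤-antisym (below m m′ same) (below m′ m (λ q → sym (same q)))
  where
  below : ∀ m m′ → (∀ q → 𝟙< m q ≡ 𝟙< m′ q) → m ≤ m′
  below m m′ same = ≤-pred (𝟙<-pos (subst (0 <_) (sym (trans (same (suc m′)) (𝟙<-suc-self m′))) (s≤s z≤n)))

⟨$⟩ʳ-from-rank : ∀ {n} (u x : Perm n) k →
  (∀ q → rank u (toℕ k) q ≡ rank x (toℕ k) q) → (∀ q → rank u (suc (toℕ k)) q ≡ rank x (suc (toℕ k)) q) →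
  u ⟨$⟩ʳ k ≡ x ⟨$⟩ʳ k
⟨$⟩ʳ-from-rank u x k before after = toℕ-injective (𝟙<-injective (λ q → +-cancelˡ-≡ (rank x (toℕ k) q) _ _ (begin
  rank x (toℕ k) q + 𝟙< (val u k) q ≡⟨ cong (_+ 𝟙< (val u k) q) (before q) ⟨
  rank u (toℕ k) q + 𝟙< (val u k) q ≡⟨ rank-suc-row u k q ⟨
  rank u (suc (toℕ k)) q            ≡⟨ after q ⟩
  rank x (suc (toℕ k)) q            ≡⟨ rank-suc-row x k q ⟩
  rank x (toℕ k) q + 𝟙< (val x k) q ∎)))
  where open ≡-Reasoning

⟨$⟩ˡ-from-rank : ∀ {n} (u x : Perm n) j →
  (∀ p → rank u p (toℕ j) ≡ rank x p (toℕ j)) → (∀ p → rank u p (suc (toℕ j)) ≡ rank x p (suc (toℕ j))) →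
  u ⟨$⟩ˡ j ≡ x ⟨$⟩ˡ j
⟨$⟩ˡ-from-rank u x j before after = toℕ-injective (𝟙<-injective (λ p → +-cancelˡ-≡ (rank x p (toℕ j)) _ _ (begin
  rank x p (toℕ j) + 𝟙< (pos u j) p ≡⟨ cong (_+ 𝟙< (pos u j) p) (before p) ⟨
  rank u p (toℕ j) + 𝟙< (pos u j) p ≡⟨ rank-suc-col u p j ⟨
  rank u p (suc (toℕ j))            ≡⟨ after p ⟩
  rank x p (suc (toℕ j))            ≡⟨ rank-suc-col x p j ⟩
  rank x p (toℕ j) + 𝟙< (pos x j) p ∎)))
  where open ≡-Reasoning

≐-or-transpose : ∀ {n} (u x : Perm n) (i a : Fin n) → i ≢ a →
  (∀ k → k ≢ i → k ≢ a → u ⟨$⟩ʳ k ≡ x ⟨$⟩ʳ k) → u ≐ x ⊎ u ≐ (x ·t[ i , a ])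
≐-or-transpose u x i a i≢a agree with value-of i (inj₁ refl) | value-of a (inj₂ refl)
  where
  value-of : ∀ c → c ≡ i ⊎ c ≡ a → (u ⟨$⟩ʳ c ≡ x ⟨$⟩ʳ i) ⊎ (u ⟨$⟩ʳ c ≡ x ⟨$⟩ʳ a)
  value-of c c∈ia with x ⟨$⟩ˡ (u ⟨$⟩ʳ c) ≟F i | x ⟨$⟩ˡ (u ⟨$⟩ʳ c) ≟F a
  ... | yes e | _ = inj₁ (trans (sym (inverseʳ x)) (cong (x ⟨$⟩ʳ_) e))
  ... | no _ | yes e = inj₂ (trans (sym (inverseʳ x)) (cong (x ⟨$⟩ʳ_) e))
  ... | no m≢i | no m≢a = ⊥-elim (⊎.[ (λ c≡i → m≢i (trans m≡c c≡i)) , (λ c≡a → m≢a (trans m≡c c≡a)) ] c∈ia)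
    where
    m≡c : x ⟨$⟩ˡ (u ⟨$⟩ʳ c) ≡ c
    m≡c = ⟨$⟩ʳ-injective u (trans (agree _ m≢i m≢a) (inverseʳ x))
... | inj₁ ui | inj₁ ua = ⊥-elim (i≢a (⟨$⟩ʳ-injective u (trans ui (sym ua))))
... | inj₂ ui | inj₂ ua = ⊥-elim (i≢a (⟨$⟩ʳ-injective u (trans ui (sym ua))))
... | inj₁ ui | inj₂ ua = inj₁ (λ k → pointwise k (k ≟F i) (k ≟F a))
  where
  pointwise : ∀ k → Dec (k ≡ i) → Dec (k ≡ a) → u ⟨$⟩ʳ k ≡ x ⟨$⟩ʳ k
  pointwise k (yes refl) _ = ui
  pointwise k (no _) (yes refl) = ua
  pointwise k (no k≢i) (no k≢a) = agree k k≢i k≢a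
... | inj₂ ui | inj₁ ua = inj₂ (λ k → pointwise k (k ≟F i) (k ≟F a))
  where
  pointwise : ∀ k → Dec (k ≡ i) → Dec (k ≡ a) → u ⟨$⟩ʳ k ≡ (x ·t[ i , a ]) ⟨$⟩ʳ k
  pointwise k (yes refl) _ = trans ui (sym (cong (x ⟨$⟩ʳ_) (transpose-i i a)))
  pointwise k (no _) (yes refl) = trans ua (sym (cong (x ⟨$⟩ʳ_) (transpose-j i a)))
  pointwise k (no k≢i) (no k≢a) = trans (agree k k≢i k≢a) (sym (cong (x ⟨$⟩ʳ_) (transpose-other i a k k≢i k≢a)))

rank-transpose-outside : ∀ {n} (x : Perm n) (i a : Fin n) → toℕ i < toℕ a → val x i < val x a → ∀ {p q} →
  ¬ InRectangle (toℕ i) (toℕ a) (val x i) (val x a) p q → rank (x ·t[ i , a ]) p q ≡ rank x p q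
rank-transpose-outside x i a ia xia {p} {q} out = begin
  rank (x ·t[ i , a ]) p q     ≡⟨ +-identityʳ _ ⟨
  rank (x ·t[ i , a ]) p q + 0 ≡⟨ cong (rank (x ·t[ i , a ]) p q +_) (rectangle-no out) ⟨
  rank (x ·t[ i , a ]) p q + rectangle (toℕ i) (toℕ a) (val x i) (val x a) p q
                               ≡⟨ rank-transpose-rectangle x i a ia xia p q ⟩
  rank x p q                   ∎
  where open ≡-Reasoning

cover-interval : ∀ {n} (x : Perm n) (i a : Fin n) → toℕ i < toℕ a → val x i < val x a → NoneBetween x i a →
  (u : Perm n) → x ≼ u → u ≼ (x ·t[ i , a ]) → u ≐ x ⊎ u ≐ (x ·t[ i , a ])
cover-interval {n} x i a ia xia none u x≼u u≼y =
  ≐-or-transpose u x i a (λ e → <-irrefl (cong toℕ e) ia) agree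
  where
  y = x ·t[ i , a ]
  Outside : ℕ → ℕ → Set
  Outside p q = ¬ InRectangle (toℕ i) (toℕ a) (val x i) (val x a) p q
  outside : ∀ p q → Outside p q → rank u p q ≡ rank x p q
  outside p q out = ≤-antisym (x≼u p q) (subst (_≤ rank u p q) (rank-transpose-outside x i a ia xia out) (u≼y p q))
  row-outside : ∀ k → (∀ p → p ≡ toℕ k ⊎ p ≡ suc (toℕ k) → ∀ q → Outside p q) → u ⟨$⟩ʳ k ≡ x ⟨$⟩ʳ k
  row-outside k out = ⟨$⟩ʳ-from-rank u x k (λ q → outside _ q (out _ (inj₁ refl) q)) (λ q → outside _ q (out _ (inj₂ refl) q))
  col-outside : ∀ j → (∀ q → q ≡ toℕ j ⊎ q ≡ suc (toℕ j) → ∀ p → Outside p q) → u ⟨$⟩ˡ j ≡ x ⟨$⟩ˡ j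
  col-outside j out = ⟨$⟩ˡ-from-rank u x j (λ p → outside p _ (out _ (inj₁ refl) p)) (λ p → outside p _ (out _ (inj₂ refl) p))
  agree : ∀ k → k ≢ i → k ≢ a → u ⟨$⟩ʳ k ≡ x ⟨$⟩ʳ k
  agree k k≢i k≢a with <-cmp (toℕ k) (toℕ i) | <-cmp (toℕ k) (toℕ a)
  ... | tri≈ _ k≡i _ | _ = ⊥-elim (k≢i (toℕ-injective k≡i))
  ... | _ | tri≈ _ k≡a _ = ⊥-elim (k≢a (toℕ-injective k≡a))
  ... | tri< k<i _ _ | _ = row-outside k λ where
    _ (inj₁ refl) _ r → <-asym k<i (proj₁ r)
    _ (inj₂ refl) _ r → <⇒≱ k<i (≤-pred (proj₁ r))
  ... | tri> _ _ _ | tri> _ _ a<k = row-outside k λ where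
    _ (inj₁ refl) _ r → proj₁ (proj₂ r) a<k
    _ (inj₂ refl) _ r → proj₁ (proj₂ r) (m<n⇒m<1+n a<k)
  ... | tri> _ _ i<k | tri< k<a _ _ =
    trans (cong (u ⟨$⟩ʳ_) (sym (trans column-agrees (inverseˡ x)))) (inverseʳ u)
    where
    xk-outside : val x k < val x i ⊎ val x a < val x k
    xk-outside with <-cmp (val x k) (val x i) | <-cmp (val x k) (val x a)
    ... | tri< xk<xi _ _ | _ = inj₁ xk<xi
    ... | tri≈ _ xk≡xi _ | _ = ⊥-elim (k≢i (val-injective x xk≡xi))
    ... | _ | tri≈ _ xk≡xa _ = ⊥-elim (k≢a (val-injective x xk≡xa))
    ... | _ | tri> _ _ xa<xk = inj₂ xa<xk
    ... | tri> _ _ xi<xk | tri< xk<xa _ _ = ⊥-elim (none k i<k k<a xi<xk xk<xa)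
    column-agrees : u ⟨$⟩ˡ (x ⟨$⟩ʳ k) ≡ x ⟨$⟩ˡ (x ⟨$⟩ʳ k)
    column-agrees with xk-outside
    ... | inj₁ xk<xi = col-outside (x ⟨$⟩ʳ k) λ where
      _ (inj₁ refl) _ r → <-asym xk<xi (proj₁ (proj₂ (proj₂ r)))
      _ (inj₂ refl) _ r → <⇒≱ xk<xi (≤-pred (proj₁ (proj₂ (proj₂ r))))
    ... | inj₂ xa<xk = col-outside (x ⟨$⟩ʳ k) λ where
      _ (inj₁ refl) _ r → proj₂ (proj₂ (proj₂ r)) xa<xk
      _ (inj₂ refl) _ r → proj₂ (proj₂ (proj₂ r)) (m<n⇒m<1+n xa<xk)

-- The lifting property

maximal : ∀ {n} (P : Fin n → Set) → (∀ k → Dec (P k)) → (k₀ : Fin n) → P k₀ →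
  Σ (Fin n) λ k → P k × (∀ k′ → P k′ → toℕ k′ ≤ toℕ k)
maximal {n} P P? k₀ pk₀ with below n k₀ (toℕ<n k₀) pk₀
  where
  below : ∀ m (k₀ : Fin n) → toℕ k₀ < m → P k₀ → Σ (Fin n) λ k → P k × (∀ k′ → toℕ k′ < m → P k′ → toℕ k′ ≤ toℕ k)
  below (suc m) k₀ k₀<1+m pk₀ with decideAt P P? m
  ... | inj₁ (k , k≡m , pk) = k , pk , (λ k′ k′<1+m _ → subst (toℕ k′ ≤_) (sym k≡m) (≤-pred k′<1+m))
  ... | inj₂ ¬pm with below m k₀ (≤∧≢⇒< (≤-pred k₀<1+m) (λ e → ¬pm k₀ e pk₀)) pk₀
  ...   | k , pk , max = k , pk , (λ k′ k′<1+m pk′ → max k′ (≤∧≢⇒< (≤-pred k′<1+m) (λ e → ¬pm k′ e pk′)) pk′)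
... | k , pk , max = k , pk , (λ k′ → max k′ (toℕ<n k′))

InBox : ∀ {n} → Perm n → ℕ → ℕ → ℕ → ℕ → Fin n → Set
InBox z p p′ q q′ k = toℕ k < p′ × ¬ (toℕ k < p) × val z k < q′ × ¬ (val z k < q)

InBox? : ∀ {n} (z : Perm n) p p′ q q′ k → Dec (InBox z p p′ q q′ k)
InBox? z p p′ q q′ k = (toℕ k <? p′) ×-dec ¬? (toℕ k <? p) ×-dec (val z k <? q′) ×-dec ¬? (val z k <? q)

boxCount : ∀ {n} → Perm n → ℕ → ℕ → ℕ → ℕ → ℕ
boxCount {n} z p p′ q q′ = ∑[ k < n ] χ (does (InBox? z p p′ q q′ k))

box-table : ∀ A A′ B B′ → (A ≡ true → A′ ≡ true) → (B ≡ true → B′ ≡ true) →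
  χ A′ * χ B′ + χ A * χ B ≡ χ A * χ B′ + χ A′ * χ B + χ (A′ ∧ not A ∧ B′ ∧ not B)
box-table true true true true _ _ = refl
box-table true true true false _ B⇒B′ with B⇒B′ refl
... | ()
box-table true true false true _ _ = refl
box-table true true false false _ _ = refl
box-table true false _ _ A⇒A′ _ with A⇒A′ refl
... | ()
box-table false true true true _ _ = refl
box-table false true true false _ B⇒B′ with B⇒B′ refl
... | ()
box-table false true false true _ _ = refl
box-table false true false false _ _ = refl
box-table false false true true _ _ = refl
box-table false false true false _ B⇒B′ with B⇒B′ refl
... | ()
box-table false false false true _ _ = refl
box-table false false false false _ _ = refl

rank-box : ∀ {n} (z : Perm n) p p′ q q′ → p ≤ p′ → q ≤ q′ →
  rank z p′ q′ + rank z p q ≡ rank z p q′ + rank z p′ q + boxCount z p p′ q q′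
rank-box {n} z p p′ q q′ p≤p′ q≤q′ = begin
  rank z p′ q′ + rank z p q
    ≡⟨ ∑-distrib-+ (cell p′ q′) (cell p q) ⟨
  ∑[ k < n ] (cell p′ q′ k + cell p q k)
    ≡⟨ sum-cong-≗ table ⟩
  ∑[ k < n ] (cell p q′ k + cell p′ q k + box k)
    ≡⟨ ∑-distrib-+ (λ k → cell p q′ k + cell p′ q k) box ⟩
  ∑[ k < n ] (cell p q′ k + cell p′ q k) + boxCount z p p′ q q′
    ≡⟨ cong (_+ boxCount z p p′ q q′) (∑-distrib-+ (cell p q′) (cell p′ q)) ⟩
  rank z p q′ + rank z p′ q + boxCount z p p′ q q′ ∎
  where
  open ≡-Reasoning
  cell : ℕ → ℕ → Fin n → ℕ
  cell r c k = 𝟙< (toℕ k) r * 𝟙< (val z k) c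
  box : Fin n → ℕ
  box k = χ (does (InBox? z p p′ q q′ k))
  table : ∀ k → cell p′ q′ k + cell p q k ≡ cell p q′ k + cell p′ q k + box k
  table k = box-table (does (toℕ k <? p)) (does (toℕ k <? p′)) (does (val z k <? q)) (does (val z k <? q′))
    (λ e → <-does (≤-trans (does-< {toℕ k} {p} e) p≤p′)) (λ e → <-does (≤-trans (does-< {val z k} {q} e) q≤q′))

boxCount-pos : ∀ {n} (z : Perm n) p p′ q q′ → 0 < boxCount z p p′ q q′ → Σ (Fin n) (InBox z p p′ q q′)
boxCount-pos {n} z p p′ q q′ pos with ∑-pos n pos
... | k , k-counts with InBox? z p p′ q q′ k
...   | yes inBox = k , inBox
...   | no ¬inBox = ⊥-elim (<-irrefl (sym (cong χ (dec-false (InBox? z p p′ q q′ k) ¬inBox))) k-counts)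

lastAgreement : ∀ {n} (u x : Perm n) (a : ℕ) → x ≼ u → ∀ m →
  Σ ℕ λ q₀ → q₀ ≤ m × rank u a q₀ ≡ rank x a q₀ × (∀ q → q₀ < q → q ≤ m → rank u a q < rank x a q)
lastAgreement u x a x≼u zero =
  0 , z≤n , trans (rank-zeroʳ u a) (sym (rank-zeroʳ x a)) , (λ q 0<q q≤0 → ⊥-elim (<-irrefl refl (≤-trans 0<q q≤0)))
lastAgreement u x a x≼u (suc m) with rank u a (suc m) ≟ rank x a (suc m)
... | yes agree = suc m , ≤-refl , agree , (λ q m<q q≤m → ⊥-elim (<-irrefl refl (≤-trans m<q q≤m)))
... | no differ with lastAgreement u x a x≼u m
...   | q₀ , q₀≤m , agree , short = q₀ , m≤n⇒m≤1+n q₀≤m , agree , short′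
  where
  short′ : ∀ q → q₀ < q → q ≤ suc m → rank u a q < rank x a q
  short′ q q₀<q q≤1+m with m≤n⇒m<n∨m≡n q≤1+m
  ... | inj₁ q<1+m = short q q₀<q (≤-pred q<1+m)
  ... | inj₂ refl = ≤∧≢⇒< (x≼u a (suc m)) differ

-- The core of the lifting property: rk_x and rk_{x t_{ia}} differ by one exactly on the rectangle
-- (i, a] × (x i, x a], and inside it the bound for u follows from the box identities with corner
-- row a, column q₀, comparing u (an inequality) with x (an equality, as the box is empty).
transpose-≼ : ∀ {n} (x u : Perm n) (i a : Fin n) → toℕ i < toℕ a → val x i < val x a → x ≼ u →
  (q₀ : ℕ) → q₀ ≤ val x i → rank u (toℕ a) q₀ ≡ rank x (toℕ a) q₀ →
  (∀ q → q₀ < q → q ≤ val x a → rank u (toℕ a) q < rank x (toℕ a) q) →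
  (∀ k → toℕ i < toℕ k → toℕ k < toℕ a → q₀ ≤ val x k → val x k < val x a → ⊥) →
  (x ·t[ i , a ]) ≼ u
transpose-≼ x u i a ia xia x≼u q₀ q₀≤xi agree short empty p q
  with InRectangle? (toℕ i) (toℕ a) (val x i) (val x a) p q
... | no out = subst (rank u p q ≤_) (sym (rank-transpose-outside x i a ia xia out)) (x≼u p q)
... | yes (i<p , a≮p , xi<q , xa≮q) = ≤-pred (subst (suc (rank u p q) ≤_) y+1≡x inside)
  where
  y = x ·t[ i , a ]
  A = toℕ a
  p≤A : p ≤ A
  p≤A = ≮⇒≥ a≮p
  q≤xa : q ≤ val x a
  q≤xa = ≮⇒≥ xa≮q
  q₀<q : q₀ < q
  q₀<q = ≤-<-trans q₀≤xi xi<q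
  y+1≡x : rank x p q ≡ suc (rank y p q)
  y+1≡x = trans (sym (rank-transpose-rectangle x i a ia xia p q))
            (trans (cong (rank y p q +_) (rectangle-yes (i<p , a≮p , xi<q , xa≮q))) (+-comm _ 1))
  boxₓ : rank x A q + rank x p q₀ ≡ rank x p q + rank x A q₀
  boxₓ = trans (rank-box x p A q₀ q p≤A (<⇒≤ q₀<q)) (trans (cong (rank x p q + rank x A q₀ +_) no-points) (+-identityʳ _))
    where
    no-points : boxCount x p A q₀ q ≡ 0
    no-points with boxCount x p A q₀ q in count
    ... | zero = refl
    ... | suc _ with boxCount-pos x p A q₀ q (subst (0 <_) (sym count) (s≤s z≤n))
    ...   | k , k<A , k≮p , xk<q , xk≮q₀ =
            ⊥-elim (empty k (<-≤-trans i<p (≮⇒≥ k≮p)) k<A (≮⇒≥ xk≮q₀) (<-≤-trans xk<q q≤xa))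
  boxᵤ : rank u p q + rank u A q₀ ≤ rank u A q + rank u p q₀
  boxᵤ = ≤-trans (m≤m+n _ _) (≤-reflexive (sym (rank-box u p A q₀ q p≤A (<⇒≤ q₀<q))))
  inside : suc (rank u p q) ≤ rank x p q
  inside = +-cancelʳ-≤ (rank x A q₀) _ _ (begin
    suc (rank u p q) + rank x A q₀   ≡⟨ cong (λ r → suc (rank u p q + r)) agree ⟨
    suc (rank u p q + rank u A q₀)   ≤⟨ s≤s boxᵤ ⟩
    suc (rank u A q + rank u p q₀)   ≤⟨ +-monoˡ-≤ (rank u p q₀) (short q q₀<q q≤xa) ⟩
    rank x A q + rank u p q₀         ≤⟨ +-monoʳ-≤ (rank x A q) (x≼u p q₀) ⟩
    rank x A q + rank x p q₀         ≡⟨ boxₓ ⟩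
    rank x p q + rank x A q₀         ∎)
    where open ≤-Reasoning

-- Where rk_u(p, ·) stops agreeing with rk_x(p, ·), rk_x(p, ·) must increase, so the entry of x in
-- that column lies above row p.
pos-<-at-rank-gap : ∀ {n} (x u : Perm n) p → x ≼ u → (j : Fin n) → rank u p (toℕ j) ≡ rank x p (toℕ j) →
  rank u p (suc (toℕ j)) < rank x p (suc (toℕ j)) → pos x j < p
pos-<-at-rank-gap x u p x≼u j agree gap with 𝟙<-dec (pos x j) p
... | inj₁ (pos<p , _) = pos<p
... | inj₂ (_ , no-step) = ⊥-elim (<-irrefl refl (begin-strict
  rank u p (suc (toℕ j)) <⟨ gap ⟩
  rank x p (suc (toℕ j)) ≡⟨ trans (rank-suc-col x p j) (trans (cong (rank x p (toℕ j) +_) no-step) (+-identityʳ _)) ⟩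
  rank x p (toℕ j)       ≡⟨ agree ⟨
  rank u p (toℕ j)       ≤⟨ rank-mono-col u p (toℕ j) ⟩
  rank u p (suc (toℕ j)) ∎))
  where open ≤-Reasoning

lifting : ∀ {n} (x u : Perm n) (a : Fin n) → x ≼ u → rank u (toℕ a) (val x a) < rank x (toℕ a) (val x a) →
  Σ (Fin n) λ i → toℕ i < toℕ a × val x i < val x a × NoneBetween x i a × (x ·t[ i , a ]) ≼ u
lifting {n} x u a x≼u drop = i , i<a , xi<xa , none , transpose-≼ x u i a i<a xi<xa x≼u q₀ q₀≤xi agree short empty
  where
  A = toℕ a
  q₀ : ℕ
  q₀ = proj₁ (lastAgreement u x A x≼u (val x a))
  agree : rank u A q₀ ≡ rank x A q₀
  agree = proj₁ (proj₂ (proj₂ (lastAgreement u x A x≼u (val x a))))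
  short : ∀ q → q₀ < q → q ≤ val x a → rank u A q < rank x A q
  short = proj₂ (proj₂ (proj₂ (lastAgreement u x A x≼u (val x a))))
  q₀<xa : q₀ < val x a
  q₀<xa = ≤∧≢⇒< (proj₁ (proj₂ (lastAgreement u x A x≼u (val x a))))
                (λ e → <-irrefl (subst (λ q → rank u A q ≡ rank x A q) e agree) drop)
  q₀<n : q₀ < n
  q₀<n = <-trans q₀<xa (toℕ<n (x ⟨$⟩ʳ a))
  j₀ = fromℕ< q₀<n
  j₀≡q₀ : toℕ j₀ ≡ q₀
  j₀≡q₀ = toℕ-fromℕ< q₀<n
  k₀ = x ⟨$⟩ˡ j₀
  xk₀≡q₀ : val x k₀ ≡ q₀
  xk₀≡q₀ = trans (val-pos x j₀) j₀≡q₀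
  k₀<a : toℕ k₀ < A
  k₀<a = pos-<-at-rank-gap x u A x≼u j₀ (subst (λ t → rank u A t ≡ rank x A t) (sym j₀≡q₀) agree)
    (short (suc (toℕ j₀)) (s≤s (≤-reflexive (sym j₀≡q₀))) (subst (λ t → suc t ≤ val x a) (sym j₀≡q₀) q₀<xa))
  Candidate : Fin n → Set
  Candidate k = toℕ k < A × q₀ ≤ val x k × val x k < val x a
  Candidate? : ∀ k → Dec (Candidate k)
  Candidate? k = (toℕ k <? A) ×-dec (q₀ ≤? val x k) ×-dec (val x k <? val x a)
  best : Σ (Fin n) λ k → Candidate k × (∀ k′ → Candidate k′ → toℕ k′ ≤ toℕ k)
  best = maximal Candidate Candidate? k₀ (k₀<a , ≤-reflexive (sym xk₀≡q₀) , subst (_< val x a) (sym xk₀≡q₀) q₀<xa)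
  i : Fin n
  i = proj₁ best
  i<a : toℕ i < A
  i<a = proj₁ (proj₁ (proj₂ best))
  q₀≤xi : q₀ ≤ val x i
  q₀≤xi = proj₁ (proj₂ (proj₁ (proj₂ best)))
  xi<xa : val x i < val x a
  xi<xa = proj₂ (proj₂ (proj₁ (proj₂ best)))
  empty : ∀ k → toℕ i < toℕ k → toℕ k < A → q₀ ≤ val x k → val x k < val x a → ⊥
  empty k i<k k<a q₀≤xk xk<xa = <⇒≱ i<k (proj₂ (proj₂ best) k (k<a , q₀≤xk , xk<xa))
  none : NoneBetween x i a
  none k i<k k<a xi<xk xk<xa = empty k i<k k<a (≤-trans q₀≤xi (<⇒≤ xi<xk)) xk<xa

≼-transpose : ∀ {n} (x : Perm n) (i a : Fin n) → toℕ i < toℕ a → val x i < val x a → x ≼ (x ·t[ i , a ])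
≼-transpose x i a ia xia p q = subst (rank (x ·t[ i , a ]) p q ≤_) (rank-transpose-rectangle x i a ia xia p q) (m≤m+n _ _)

<B-transpose : ∀ {n} (x : Perm n) (i a : Fin n) → toℕ i < toℕ a → val x i < val x a → x <B (x ·t[ i , a ])
<B-transpose x i a ia xia =
  Equivalence.from (≤B⇔≼ x (x ·t[ i , a ])) (≼-transpose x i a ia xia) ,
  (λ same → <-irrefl (cong toℕ (⟨$⟩ʳ-injective x (trans (same i) (cong (x ⟨$⟩ʳ_) (transpose-i i a))))) ia)

≤B-transpose⇒< : ∀ {n} (x : Perm n) (i a : Fin n) → toℕ i < toℕ a → x ≤B (x ·t[ i , a ]) → val x i < val x a
≤B-transpose⇒< x i a ia x≤y with <-cmp (val x i) (val x a)
... | tri< xi<xa _ _ = xi<xa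
... | tri≈ _ xi≡xa _ = ⊥-elim (<-irrefl (cong toℕ (val-injective x xi≡xa)) ia)
... | tri> _ _ xa<xi = ⊥-elim (<-irrefl refl (≤-trans (≤-reflexive (sym rank-up)) (Equivalence.to (≤B⇔≼ x y) x≤y (toℕ a) (val x i))))
  where
  y = x ·t[ i , a ]
  rank-up : rank y (toℕ a) (val x i) ≡ suc (rank x (toℕ a) (val x i))
  rank-up = cancel (rank-transpose x i a (λ e → <-irrefl (cong toℕ e) ia) (toℕ a) (val x i))
              (𝟙<-yes ia) (𝟙<-irrefl (val x i)) (𝟙<-irrefl (toℕ a)) (𝟙<-yes xa<xi)
    where
    cancel : ∀ {s r lᵢ lᵢᵢ lₐ lₐᵢ lₐₐ lᵢₐ : ℕ} → s + lᵢ * lᵢᵢ + lₐ * lₐₐ ≡ r + lᵢ * lₐᵢ + lₐ * lᵢₐ →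
      lᵢ ≡ 1 → lᵢᵢ ≡ 0 → lₐ ≡ 0 → lₐᵢ ≡ 1 → s ≡ suc r
    cancel {s} {r} e refl refl refl refl = trans (sym (trans (+-identityʳ _) (+-identityʳ s))) (trans e (trans (+-identityʳ _) (+-comm r 1)))

-- Covers of v = w t_{a, w⁻¹(b)} at a lower outside corner

module _ {n} (w : Perm n) (a b : Fin n) (corner : LowerOutsideCorner w a b) where

  private
    c = w ⟨$⟩ˡ b
    v = vOf w a b
    A = toℕ a
    B = toℕ b
    a<c : A < toℕ c
    a<c = proj₂ (proj₁ corner)
    b<wa : B < val w a
    b<wa = proj₁ (proj₁ corner)

  val-v-a : val v a ≡ B
  val-v-a = trans (val-transpose-i w a c) (val-pos w b)

  ℓ-w≡1+ℓ-v : ℓ w ≡ suc (ℓ v)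
  ℓ-w≡1+ℓ-v = trans (ℓ-resp-≐ w (v ·t[ a , c ]) (·t-involutive w a c))
    (ℓ-transpose-cover v a c a<c (subst₂ _<_ (sym val-v-a) (sym (val-transpose-j w a c)) b<wa) none)
    where
    -- An entry of v at a row k strictly between a and c with value in (b, w a) would make (k, b) a cell
    -- of D(w) below (a, b).
    none : NoneBetween v a c
    none k a<k k<c vak vkc = <-irrefl (cong toℕ (sym (proj₁ (proj₂ corner k b in-D (<⇒≤ a<k) ≤-refl)))) a<k
      where
      k≢a : k ≢ a
      k≢a e = <-irrefl (cong toℕ (sym e)) a<k
      k≢c : k ≢ c
      k≢c e = <-irrefl (cong toℕ e) k<c
      in-D : InD w k b
      in-D = subst (B <_) (val-transpose-other w a c k k≢a k≢c) (subst (_< val v k) val-v-a vak) , k<c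

  rk-w≡rank-v : rk w (suc A) (suc B) ≡ rank v A B
  rk-w≡rank-v = begin
    rk w (suc A) (suc B)                   ≡⟨ rk≡rank w (suc A) (suc B) ⟩
    rank w (suc A) (suc B)                 ≡⟨ rank-suc-row w a (suc B) ⟩
    rank w A (suc B) + 𝟙< (val w a) (suc B) ≡⟨ cong₂ _+_ (rank-suc-col w A b) (𝟙<-no (λ wa<1+b → <⇒≱ b<wa (≤-pred wa<1+b))) ⟩
    rank w A B + 𝟙< (pos w b) A + 0       ≡⟨ cong (λ t → rank w A B + t + 0) (𝟙<-no (<-asym a<c)) ⟩
    rank w A B + 0 + 0                     ≡⟨ trans (+-identityʳ _) (+-identityʳ _) ⟩
    rank w A B                             ≡⟨ rank-unchanged ⟨
    rank v A B                             ∎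
    where
    open ≡-Reasoning
    rank-unchanged : rank v A B ≡ rank w A B
    rank-unchanged = cancel (rank-transpose w a c (λ e → <-irrefl (cong toℕ e) a<c) A B)
      (cong (_* 𝟙< (val w a) B) (𝟙<-irrefl A)) (cong (_* 𝟙< (val w c) B) (𝟙<-no (<-asym a<c)))
      (cong (_* 𝟙< (val w c) B) (𝟙<-irrefl A)) (cong (_* 𝟙< (val w a) B) (𝟙<-no (<-asym a<c)))
      where
      cancel : ∀ {s r t₁ t₂ t₃ t₄ : ℕ} → s + t₁ + t₂ ≡ r + t₃ + t₄ → t₁ ≡ 0 → t₂ ≡ 0 → t₃ ≡ 0 → t₄ ≡ 0 → s ≡ r
      cancel {s} {r} e refl refl refl refl = trans (sym (trans (+-identityʳ _) (+-identityʳ s))) (trans e (trans (+-identityʳ _) (+-identityʳ r)))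

  rank-cover-corner : ∀ i → toℕ i < A → val v i < val v a → suc (rank (v ·t[ i , a ]) A B) ≡ rank v A B
  rank-cover-corner i i<a vi<va = trans (+-comm 1 _) (trans (cong (rank (v ·t[ i , a ]) A B +_) (sym in-rectangle))
    (rank-transpose-rectangle v i a i<a vi<va A B))
    where
    in-rectangle : rectangle (toℕ i) A (val v i) (val v a) A B ≡ 1
    in-rectangle = rectangle-yes (i<a , n≮n A , subst (val v i <_) val-v-a vi<va , (λ va<b → <-irrefl refl (subst (_< B) val-v-a va<b)))

  Inφ⇔ : ∀ i → Inφ w a b i ⇔ (toℕ i < A × val v i < val v a × NoneBetween v i a)
  Inφ⇔ i = mk⇔
    (λ (i<a , (v≤y , _) , ℓ-y) → i<a , vi<va i<a v≤y , ℓ-transpose-suc⇒NoneBetween v i a i<a (vi<va i<a v≤y) ℓ-y)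
    (λ (i<a , vi<va , none) → i<a , <B-transpose v i a i<a vi<va , ℓ-transpose-cover v i a i<a vi<va none)
    where
    vi<va : toℕ i < A → v ≤B (v ·t[ i , a ]) → val v i < val v a
    vi<va i<a = ≤B-transpose⇒< v i a i<a

  ℓ-Φ : ∀ u → InΦ w a b u → ℓ u ≡ ℓ w
  ℓ-Φ u (i , (_ , _ , ℓ-y) , u≐y) = trans (ℓ-resp-≐ u (v ·t[ i , a ]) u≐y) (trans ℓ-y (sym ℓ-w≡1+ℓ-v))

  -- rk_w(a, b) ≥ 1 yields some k above row a with v k < v a = b; the lowest such k leaves no entry of v
  -- between it and a.
  Φ-nonempty : 1 ≤ rk w (suc A) (suc B) → Σ (Perm n) (InΦ w a b)
  Φ-nonempty r≥1 with ∑-pos n {λ k → 𝟙< (toℕ k) A * 𝟙< (val v k) B} (subst (1 ≤_) rk-w≡rank-v r≥1)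
  ... | k , k-counts with *-pos (𝟙< (toℕ k) A) (𝟙< (val v k) B) k-counts
  ...   | k<a , vk<b = v ·t[ i , a ] , i , Equivalence.from (Inφ⇔ i) (i<a , vi<va , none) , (λ _ → refl)
    where
    Below : Fin n → Set
    Below k = toℕ k < A × val v k < val v a
    best : Σ (Fin n) λ k → Below k × (∀ k′ → Below k′ → toℕ k′ ≤ toℕ k)
    best = maximal Below (λ k → (toℕ k <? A) ×-dec (val v k <? val v a)) k (𝟙<-pos k<a , subst (val v k <_) (sym val-v-a) (𝟙<-pos vk<b))
    i : Fin n
    i = proj₁ best
    i<a : toℕ i < A
    i<a = proj₁ (proj₁ (proj₂ best))
    vi<va : val v i < val v a
    vi<va = proj₂ (proj₁ (proj₂ best))
    none : NoneBetween v i a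
    none k i<k k<a _ vk<va = <⇒≱ i<k (proj₂ (proj₂ best) k (k<a , vk<va))

≤∸1⇔< : ∀ {m r} → 1 ≤ r → m ≤ r ∸ 1 ⇔ m < r
≤∸1⇔< {r = suc r} _ = mk⇔ s≤s ≤-pred

module _ {n} (w : Perm n) (a b : Fin n) (corner : LowerOutsideCorner w a b)
         (π : Perm n) (bigrass : IsBigrassAt π a b (rk w (suc (toℕ a)) (suc (toℕ b)) ∸ 1)) where

  private
    v = vOf w a b
    A = toℕ a
    B = toℕ b
    J = permMatrix v ∨ permMatrix π

  π≼⇔ : ∀ u → π ≼ u ⇔ rank u A B ≤ rank π A B
  π≼⇔ u = mk⇔ (λ π≼u → π≼u A B) (λ bound → essential-set-criterion π u (at-corner bound))
    where
    at-corner : rank u A B ≤ rank π A B → RankBoundedOnEss π u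
    at-corner bound e f ess with Equivalence.to (proj₁ bigrass e f) ess
    ... | e+1≡a , f+1≡b = subst₂ (λ p q → rank u p q ≤ rank π p q) (sym e+1≡a) (sym f+1≡b) bound

  rank-π : rank π A B ≡ rank v A B ∸ 1
  rank-π = trans (sym (rk≡rank π A B)) (trans (proj₂ bigrass) (cong (_∸ 1) (rk-w≡rank-v w a b corner)))

  ≥join⇔ : 1 ≤ rk w (suc A) (suc B) → ∀ u → u ≥M J ⇔ (v ≼ u × rank u A B < rank v A B)
  ≥join⇔ r≥1 u = mk⇔
    (λ u≥J → let (v≼u , π≼u) = Equivalence.to (≥M-∨⇔ u v π) u≥J in v≼u , below-π⇒< (Equivalence.to (π≼⇔ u) π≼u))
    (λ (v≼u , drop) → Equivalence.from (≥M-∨⇔ u v π) (v≼u , Equivalence.from (π≼⇔ u) (<⇒below-π drop)))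
    where
    r≥1′ : 1 ≤ rank v A B
    r≥1′ = subst (1 ≤_) (rk-w≡rank-v w a b corner) r≥1
    below-π⇒< : rank u A B ≤ rank π A B → rank u A B < rank v A B
    below-π⇒< bound = Equivalence.to (≤∸1⇔< r≥1′) (subst (rank u A B ≤_) rank-π bound)
    <⇒below-π : rank u A B < rank v A B → rank u A B ≤ rank π A B
    <⇒below-π drop = subst (rank u A B ≤_) (sym rank-π) (Equivalence.from (≤∸1⇔< r≥1′) drop)

  cover-≥join : 1 ≤ rk w (suc A) (suc B) → ∀ i → toℕ i < A → val v i < val v a → (v ·t[ i , a ]) ≥M J
  cover-≥join r≥1 i i<a vi<va = Equivalence.from (≥join⇔ r≥1 (v ·t[ i , a ]))
    (≼-transpose v i a i<a vi<va , subst (rank (v ·t[ i , a ]) A B <_) (rank-cover-corner w a b corner i i<a vi<va) (n<1+n _))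

  minimal⇒Φ : 1 ≤ rk w (suc A) (suc B) → ∀ u → InPermSet J u → InΦ w a b u
  minimal⇒Φ r≥1 u (u≥J , minimal) = from-cover (lifting v u a v≼u drop)
    where
    v≼u : v ≼ u
    v≼u = proj₁ (Equivalence.to (≥join⇔ r≥1 u) u≥J)
    drop : rank u A (val v a) < rank v A (val v a)
    drop = subst (λ q → rank u A q < rank v A q) (sym (val-v-a w a b corner)) (proj₂ (Equivalence.to (≥join⇔ r≥1 u) u≥J))
    from-cover : (Σ (Fin n) λ i → toℕ i < A × val v i < val v a × NoneBetween v i a × (v ·t[ i , a ]) ≼ u) → InΦ w a b u
    from-cover (i , i<a , vi<va , none , y≼u) = i , Equivalence.from (Inφ⇔ w a b corner i) (i<a , vi<va , none) , u≐y (≐-dec y u)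
      where
      y = v ·t[ i , a ]
      u≐y : Dec (y ≐ u) → u ≐ y
      u≐y (yes y≐u) k = sym (y≐u k)
      u≐y (no y≢u) = ⊥-elim (minimal y (cover-≥join r≥1 i i<a vi<va) (Equivalence.from (≤B⇔≼ y u) y≼u , y≢u))

  Φ⇒minimal : 1 ≤ rk w (suc A) (suc B) → ∀ u → InΦ w a b u → InPermSet J u
  Φ⇒minimal r≥1 u (i , φ , u≐y) = ≥M-resp-≐ y u (λ k → sym (u≐y k)) (cover-≥join r≥1 i i<a vi<va) , minimal
    where
    y = v ·t[ i , a ]
    i<a : toℕ i < A
    i<a = proj₁ (Equivalence.to (Inφ⇔ w a b corner i) φ)
    vi<va : val v i < val v a
    vi<va = proj₁ (proj₂ (Equivalence.to (Inφ⇔ w a b corner i) φ))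
    none : NoneBetween v i a
    none = proj₂ (proj₂ (Equivalence.to (Inφ⇔ w a b corner i) φ))
    -- A permutation strictly between J and u lies in the Bruhat interval [v, y], which is {v, y}.
    minimal : ∀ u′ → u′ ≥M J → ¬ (u′ <B u)
    minimal u′ u′≥J (u′≤u , u′≢u) = excluded (cover-interval v i a i<a vi<va none u′ v≼u′ u′≼y)
      where
      v≼u′ : v ≼ u′
      v≼u′ = proj₁ (Equivalence.to (≥join⇔ r≥1 u′) u′≥J)
      u′≼y : u′ ≼ y
      u′≼y p q = subst (_≤ rank u′ p q) (rank-resp-≐ u y u≐y p q) (Equivalence.to (≤B⇔≼ u′ u) u′≤u p q)
      excluded : u′ ≐ v ⊎ u′ ≐ y → ⊥
      excluded (inj₁ u′≐v) = <-irrefl (rank-resp-≐ u′ v u′≐v A B) (proj₂ (Equivalence.to (≥join⇔ r≥1 u′) u′≥J))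
      excluded (inj₂ u′≐y) = u′≢u (λ k → trans (u′≐y k) (sym (u≐y k)))

proposition4p6 : ∀ (n : ℕ) (w : Perm n) (a b : Fin n)
    → LowerOutsideCorner w a b
    → 1 ≤ rk w (suc (toℕ a)) (suc (toℕ b))
    → ∀ (π : Perm n)
    → IsBigrassAt π a b (rk w (suc (toℕ a)) (suc (toℕ b)) ∸ 1)
    → (∀ (u : Perm n) → InPermSet (permMatrix (vOf w a b) ∨ permMatrix π) u ⇔ InΦ w a b u)
      × IsDeg (permMatrix (vOf w a b) ∨ permMatrix π) (ℓ w)
proposition4p6 n w a b corner r≥1 π bigrass = Perm≡Φ , degree (Φ-nonempty w a b corner r≥1)
  where
  J = permMatrix (vOf w a b) ∨ permMatrix π
  Perm≡Φ : ∀ u → InPermSet J u ⇔ InΦ w a b u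
  Perm≡Φ u = mk⇔ (minimal⇒Φ w a b corner π bigrass r≥1 u) (Φ⇒minimal w a b corner π bigrass r≥1 u)
  degree : Σ (Perm n) (InΦ w a b) → IsDeg J (ℓ w)
  degree (y₀ , y₀∈Φ) =
    (y₀ , Equivalence.from (Perm≡Φ y₀) y₀∈Φ , ℓ-Φ w a b corner y₀ y₀∈Φ) ,
    (λ u u∈Perm → ≤-reflexive (sym (ℓ-Φ w a b corner u (Equivalence.to (Perm≡Φ u) u∈Perm))))
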